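{- Let $X$ be a finite set and $\mathfrak p\subseteq 2^X$ satisfy: (a) if $A\in\mathfrak p$ and $B\subset A$ then $B\in\mathfrak p$; (b) for $A\subseteq X$ with $|A|\ge 2$, if $\{x,y\}\in\mathfrak p$ for all distinct $x,y\in A$ then $A\in\mathfrak p$; (c) $\{x\}\in\mathfrak p$ for every $x\in X$. Suppose $(X,\mathfrak p)$ is symmetric and connected. Let $A_1,\dots,A_m\subseteq X$ form a cross-$\mathfrak p$-family with $A_1\neq\emptyset$. Then $$\sum_{i=1}^m|A_i|\le\begin{cases}|X| & \text{if } m\le \frac{|X|}{\alpha(X,\mathfrak p)},\\ m\,\alpha(X,\mathfrak p) & \text{if } m\ge \frac{|X|}{\alpha(X,\mathfrak p)},\end{cases}$$ and the bound is attained if and only if one of the following holds: (i) $m<\frac{|X|}{\alpha(X,\mathfrak p)}$ and $A_1=X$, $A_2=\dots=A_m=\emptyset$; (ii) $m>\frac{|X|}{\alpha(X,\mathfrak p)}$ and $A_1=\dots=A_m=I$ for some $I\in\mathfrak p$ with $|I|=\alpha(X,\mathfrak p)$; (iii) $m=\frac{|X|}{\alpha(X,\mathfrak p)}$ and either $A_1,\dots,A_m$ are as in (i) or as in (ii), or there is an imprimitive $\mathfrak p$-subset $A$ such that $A\subseteq A_i$ for all $i=1,\dots,m$, and, writing $A_i'=A_i\setminus A$, the family $\{A_1',\dots,A_m'\}$ is a cross-$\mathfrak p$-family and a partition of $\bar N[A]$.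
   Context: $(X,\mathfrak p)$ is symmetric if there is a group $\Gamma$ acting transitively on $X$ such that $\delta(A)\in\mathfrak p$ for every $A\in\mathfrak p$ and $\delta\in\Gamma$. $(X,\mathfrak p)$ is connected if the simple graph with vertex set $X$ in which distinct $a,b$ are adjacent iff $\{a,b\}\notin\mathfrak p$ is connected. A family $\{A_1,\dots,A_m\}$ of subsets of $X$ is a cross-$\mathfrak p$-family if $\{a,b\}\in\mathfrak p$ for all $a\in A_i$, $b\in A_j$ with $i\neq j$. $\alpha(X,\mathfrak p)=\max\{|B|:B\in\mathfrak p\}$. For $A\subseteq X$, $N[A]=A\cup\{b\in X:\{a,b\}\notin\mathfrak p\text{ for some }a\in A\}$ and $\bar N[A]=X\setminus N[A]$. A nonempty $A\in\mathfrak p$ is an imprimitive $\mathfrak p$-subset if $|A|<\alpha(X,\mathfrak p)$ and $\frac{|A|}{|N[A]|}=\frac{\alpha(X,\mathfrak p)}{|X|}$. -}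

module Defs where

open import Level using (0ℓ)
open import Data.Bool using (Bool; true; false; T; _∧_; _∨_; not; if_then_else_)
open import Data.Nat using (ℕ; zero; suc; _⊔_; _≤_; _<_; _*_; _≤?_)
open import Data.Fin using (Fin; zero; suc; _≟_)
open import Data.Vec using (Vec; []; _∷_; lookup; tabulate)
open import Data.List as List using (List; [_]; _++_)
open import Data.Nat.ListAction using (sum)
open import Data.Fin.Subset using (Subset; ⁅_⁆; _∪_; _∈_; _∉_; _⊆_; _⊂_; _─_; ∣_∣; ∁)
open import Data.Product using (Σ; ∃; _×_; _,_)
open import Relation.Nullary using (¬_; does)
open import Relation.Nullary.Decidable using (⌊_⌋)
open import Relation.Binary.PropositionalEquality using (_≡_)
open import Algebra.Bundles using (Group)

-- X is modelled as Fin n; a family 𝔭 ⊆ 2^X as a Boolean-valued predicate on Subset n.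
Family : ℕ → Set
Family n = Subset n → Bool

_∈𝔭_ : ∀ {n} → Subset n → Family n → Set
A ∈𝔭 𝔭 = T (𝔭 A)

_∉𝔭_ : ∀ {n} → Subset n → Family n → Set
A ∉𝔭 𝔭 = ¬ (A ∈𝔭 𝔭)

pair : ∀ {n} → Fin n → Fin n → Subset n
pair a b = ⁅ a ⁆ ∪ ⁅ b ⁆

anyFin : ∀ {n} → (Fin n → Bool) → Bool
anyFin {zero}  f = false
anyFin {suc n} f = f zero ∨ anyFin (λ x → f (suc x))

image : ∀ {n} → (Fin n → Fin n) → Subset n → Subset n
image f A = tabulate (λ y → anyFin (λ x → lookup A x ∧ ⌊ f x ≟ y ⌋))

allSubsets : ∀ n → List (Subset n)
allSubsets zero    = [ [] ]
allSubsets (suc n) = List.map (true ∷_) (allSubsets n) ++ List.map (false ∷_) (allSubsets n)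

α : ∀ {n} → Family n → ℕ
α {n} 𝔭 = List.foldr (λ B acc → if 𝔭 B then ∣ B ∣ ⊔ acc else acc) 0 (allSubsets n)

DownClosed : ∀ {n} → Family n → Set
DownClosed 𝔭 = ∀ A B → A ∈𝔭 𝔭 → B ⊂ A → B ∈𝔭 𝔭

PairwiseClosed : ∀ {n} → Family n → Set
PairwiseClosed 𝔭 = ∀ A → 2 ≤ ∣ A ∣ →
  (∀ x y → x ∈ A → y ∈ A → ¬ (x ≡ y) → pair x y ∈𝔭 𝔭) → A ∈𝔭 𝔭

SingletonsIn : ∀ {n} → Family n → Set
SingletonsIn 𝔭 = ∀ x → ⁅ x ⁆ ∈𝔭 𝔭

-- A group Γ acting on X (action respecting the setoid equality of Γ),
-- transitively, with δ(A) ∈ 𝔭 for all A ∈ 𝔭 and δ ∈ Γ.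
record SymmetricVia {n} (Γ : Group 0ℓ 0ℓ) (𝔭 : Family n) : Set where
  open Group Γ
  field
    act        : Carrier → Fin n → Fin n
    act-cong   : ∀ {g h} → g ≈ h → ∀ x → act g x ≡ act h x
    act-ε      : ∀ x → act ε x ≡ x
    act-∙      : ∀ g h x → act (g ∙ h) x ≡ act g (act h x)
    transitive : ∀ x y → ∃ λ g → act g x ≡ y
    preserves  : ∀ g A → A ∈𝔭 𝔭 → image (act g) A ∈𝔭 𝔭

Symmetric : ∀ {n} → Family n → Set₁
Symmetric 𝔭 = Σ (Group 0ℓ 0ℓ) λ Γ → SymmetricVia Γ 𝔭

-- the graph: distinct a,b adjacent iff {a,b} ∉ 𝔭
Adj : ∀ {n} → Family n → Fin n → Fin n → Set
Adj 𝔭 a b = ¬ (a ≡ b) × pair a b ∉𝔭 𝔭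

data Reach {n} (𝔭 : Family n) (a : Fin n) : Fin n → Set where
  here : Reach 𝔭 a a
  step : ∀ {b c} → Reach 𝔭 a b → Adj 𝔭 b c → Reach 𝔭 a c

Connected : ∀ {n} → Family n → Set
Connected 𝔭 = ∀ a b → Reach 𝔭 a b

CrossFamily : ∀ {n m} → Family n → (Fin m → Subset n) → Set
CrossFamily 𝔭 A = ∀ i j → ¬ (i ≡ j) → ∀ a b → a ∈ A i → b ∈ A j → pair a b ∈𝔭 𝔭

N : ∀ {n} → Family n → Subset n → Subset n
N 𝔭 A = tabulate (λ b → lookup A b ∨ anyFin (λ a → lookup A a ∧ not (𝔭 (pair a b))))

N̄ : ∀ {n} → Family n → Subset n → Subset n
N̄ 𝔭 A = ∁ (N 𝔭 A)

-- imprimitive 𝔭-subset; |A|/|N[A]| = α/|X| written as |A|·|X| = α·|N[A]|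
Imprimitive : ∀ {n} → Family n → Subset n → Set
Imprimitive {n} 𝔭 A =
  (∃ λ x → x ∈ A) × A ∈𝔭 𝔭 × ∣ A ∣ < α 𝔭 × ∣ A ∣ * n ≡ α 𝔭 * ∣ N 𝔭 A ∣

-- {B_1,…,B_m} is a partition of S: pairwise disjoint, union equal to S (parts may be empty)
PartitionOf : ∀ {n m} → (Fin m → Subset n) → Subset n → Set
PartitionOf {n} B S =
  (∀ i j → ¬ (i ≡ j) → ∀ (x : Fin n) → x ∈ B i → x ∈ B j → Data.Empty.⊥)
  × (∀ i → B i ⊆ S) × (∀ x → x ∈ S → ∃ λ i → x ∈ B i)
  where import Data.Empty

sizeSum : ∀ {n m} → (Fin m → Subset n) → ℕ
sizeSum A = sum (List.tabulate (λ i → ∣ A i ∣))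

-- the bound: |X| if m ≤ |X|/α, and m·α if m ≥ |X|/α (m ≤ |X|/α written m·α ≤ |X|)
bound : ℕ → ℕ → ℕ → ℕ
bound n m a = if does (m * a ≤? n) then n else m * a

-- shape (i): A_1 = X, A_2 = … = A_m = ∅   (family indexed by Fin (suc k), A_1 = A zero)
ShapeI : ∀ {n k} → (Fin (suc k) → Subset n) → Set
ShapeI A = A zero ≡ Data.Fin.Subset.⊤ × (∀ j → A (suc j) ≡ Data.Fin.Subset.⊥)
  where import Data.Fin.Subset

ShapeII : ∀ {n m} → Family n → (Fin m → Subset n) → Set
ShapeII {n} 𝔭 A = Σ (Subset n) λ I → I ∈𝔭 𝔭 × ∣ I ∣ ≡ α 𝔭 × (∀ i → A i ≡ I)

ShapeIII : ∀ {n m} → Family n → (Fin m → Subset n) → Set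
ShapeIII {n} 𝔭 A = Σ (Subset n) λ C → Imprimitive 𝔭 C × (∀ i → C ⊆ A i)
  × CrossFamily 𝔭 (λ i → A i ─ C) × PartitionOf (λ i → A i ─ C) (N̄ 𝔭 C)

module Submission where

-- Write n = |X|, a = α, s = Σ|A_i|, and let the core M be the set of points lying in
-- at least two members; t = |M|, ν = |N[M]|.  Cross-independence puts M in 𝔭 and
-- bounds how often a point is covered: at most m times on M, at most once outside
-- N[M], never on N[M] ∖ M.  Hence the counting bound s + ν ≤ m·t + n.  Symmetry gives
-- the ratio bound n·|S| ≤ a·|N[S]| for every S ∈ 𝔭: the endomorphisms v of the graph
-- of non-𝔭 pairs hit every point equally often (transitivity), so averaging the sizes
-- of the independent sets (v⁻¹(J) ∖ N[S]) ∪ S, for J a largest member of 𝔭, over all v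
-- gives a − a·ν/n + |S| ≤ a.  Eliminating ν (module Balance) yields s ≤ n if m·a ≤ n and
-- s ≤ m·a if m·a ≥ n, using t ≤ a.  At equality both bounds are tight, and t = 0
-- (shape (i), by connectivity), t = a (shape (ii)) or 0 < t < a (shape (iii), M
-- imprimitive) according to the case; conversely each shape attains the bound.

open import Defs
open import Data.Nat using (ℕ; suc; _≤_; _<_; _*_)
open import Data.Fin using (Fin; zero)
open import Data.Fin.Subset using (Subset; Nonempty)
open import Data.Product using (_×_)
open import Data.Sum using (_⊎_)
open import Function.Bundles using (_⇔_)
open import Relation.Binary.PropositionalEquality using (_≡_)

open import Level using (0ℓ)
open import Function.Bundles using (Equivalence; mk⇔)
open import Algebra.Bundles using (Group)
open import Data.Bool using (Bool; true; false; T; _∧_; _∨_; not; if_then_else_)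
open import Data.Bool.Properties using (T?; T-≡; T-∧; T-∨)
open import Data.Nat using (zero; _+_; _⊔_; _≤?_; _≤ᵇ_; z≤n; s≤s; NonZero; >-nonZero)
import Data.Nat as ℕ
open import Data.Nat.Properties hiding (_≟_)
open import Data.Fin using (suc; _≟_)
import Data.Fin.Properties as Finₚ
open import Data.Fin.Subset using (_∈_; _∉_; _⊆_; _⊂_; _─_; ⁅_⁆; ∣_∣; ∁)
import Data.Fin.Subset.Properties as Subₚ
import Data.Vec as Vec
open import Data.Vec using (Vec; []; _∷_; lookup; tabulate; here; there)
import Data.Vec.Properties as Vecₚ
import Data.List as List
import Data.Nat.ListAction as ListAction
open import Data.List using (List; []; _∷_)
import Data.List.Membership.Propositional as Listₘ
import Data.List.Membership.Propositional.Properties as ∈ₚ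
import Data.List.Relation.Unary.Any as Any
import Data.List.Relation.Unary.All as All
import Data.List.Properties as Listₚ
open import Data.List.Relation.Unary.Unique.Propositional using (Unique; []; _∷_)
import Data.List.Relation.Unary.Unique.Propositional.Properties as Uniqueₚ
open import Data.Product using (∃; _,_; proj₁; proj₂)
open import Data.Sum using (inj₁; inj₂)
import Data.Empty as Empty
open import Data.Empty using (⊥-elim)
open import Relation.Nullary using (¬_; ¬?; yes; no)
open import Relation.Unary using (Decidable)
open import Data.Nat.Tactic.RingSolver using (solve-∀)
open import Relation.Nullary.Decidable using (⌊_⌋; toWitness; fromWitness; _×-dec_; _→-dec_; decidable-stable)
open import Relation.Binary.Definitions using (tri<; tri≈; tri>)
open import Relation.Binary.PropositionalEquality
  using (refl; sym; trans; cong; cong₂; subst; subst₂; module ≡-Reasoning)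
open import Algebra.Properties.CommutativeMonoid.Sum +-0-commutativeMonoid
  using (∑-distrib-+; ∑-comm; sum-cong-≗) renaming (sum to ∑)
open import Algebra.Properties.Semiring.Sum +-*-semiring using (*-distribˡ-sum)
open import Algebra.Properties.CommutativeSemigroup *-commutativeSemigroup
  using () renaming (x∙yz≈y∙xz to *-left-comm)

not⁻ : ∀ {b} → T (not b) → ¬ T b
not⁻ {true} () _

not⁺ : ∀ {b} → ¬ T b → T (not b)
not⁺ {true}  ¬b = ¬b _
not⁺ {false} ¬b = _

𝟙 : Bool → ℕ
𝟙 true  = 1
𝟙 false = 0

𝟙≤1 : ∀ b → 𝟙 b ≤ 1
𝟙≤1 true  = s≤s z≤n
𝟙≤1 false = z≤n

𝟙-T : ∀ {b} → T b → 𝟙 b ≡ 1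
𝟙-T {true} _ = refl

𝟙-¬T : ∀ {b} → ¬ T b → 𝟙 b ≡ 0
𝟙-¬T {true}  h = ⊥-elim (h _)
𝟙-¬T {false} h = refl

𝟙-pos : ∀ {b} → 0 < 𝟙 b → T b
𝟙-pos {true} _ = _

𝟙-∧ : ∀ a b → 𝟙 (a ∧ b) ≡ 𝟙 a * 𝟙 b
𝟙-∧ true  b = sym (+-identityʳ (𝟙 b))
𝟙-∧ false b = refl

𝟙-not : ∀ b → 𝟙 (not b) + 𝟙 b ≡ 1
𝟙-not true  = refl
𝟙-not false = refl

∑-const : ∀ n c → ∑ {n} (λ _ → c) ≡ n * c
∑-const zero    c = refl
∑-const (suc n) c = cong (c +_) (∑-const n c)

∑-mono : ∀ {n} {f g : Fin n → ℕ} → (∀ i → f i ≤ g i) → ∑ f ≤ ∑ g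
∑-mono {zero}  le = z≤n
∑-mono {suc n} le = +-mono-≤ (le zero) (∑-mono (λ i → le (suc i)))

∑-*ʳ : ∀ {n} (f : Fin n → ℕ) c → ∑ (λ i → f i * c) ≡ ∑ f * c
∑-*ʳ f c = trans (sum-cong-≗ (λ i → *-comm (f i) c))
                 (trans (sym (*-distribˡ-sum c f)) (*-comm c (∑ f)))

∑-point : ∀ {n} (f : Fin n → ℕ) i → f i ≤ ∑ f
∑-point f zero    = m≤m+n (f zero) _
∑-point f (suc i) = ≤-trans (∑-point (λ j → f (suc j)) i) (m≤n+m _ (f zero))

∑-pair : ∀ {n} (f : Fin n → ℕ) i j → ¬ i ≡ j → f i + f j ≤ ∑ f
∑-pair f zero    zero    i≢j = ⊥-elim (i≢j refl)
∑-pair f zero    (suc j) i≢j = +-monoʳ-≤ (f zero) (∑-point (λ k → f (suc k)) j)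
∑-pair f (suc i) zero    i≢j =
  subst (_≤ ∑ f) (+-comm (f zero) (f (suc i))) (+-monoʳ-≤ (f zero) (∑-point (λ k → f (suc k)) i))
∑-pair f (suc i) (suc j) i≢j =
  ≤-trans (∑-pair (λ k → f (suc k)) i j (λ i≡j → i≢j (cong suc i≡j))) (m≤n+m _ (f zero))

∑-pos : ∀ {n} (f : Fin n → ℕ) → 0 < ∑ f → ∃ λ i → 0 < f i
∑-pos {suc n} f pos with f zero in eq
... | suc _ = zero , subst (0 <_) (sym eq) (s≤s z≤n)
... | zero  with ∑-pos (λ i → f (suc i)) pos
...   | i , fi>0 = suc i , fi>0

∑-tight : ∀ {n} (f g : Fin n → ℕ) → (∀ i → f i ≤ g i) → ∑ g ≤ ∑ f → ∀ i → f i ≡ g i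
∑-tight f g le ge zero = ≤-antisym (le zero)
  (+-cancelʳ-≤ _ _ _ (≤-trans (+-monoʳ-≤ (g zero) (∑-mono (λ i → le (suc i)))) ge))
∑-tight f g le ge (suc i) = ∑-tight (λ j → f (suc j)) (λ j → g (suc j)) (λ j → le (suc j))
  (+-cancelˡ-≤ (g zero) _ _ (≤-trans ge (+-monoˡ-≤ _ (le zero)))) i

∑-only : ∀ {n} (f : Fin n → ℕ) z → (∀ y → ¬ y ≡ z → f y ≡ 0) → ∑ f ≡ f z
∑-only {suc n} f zero vanish = begin
  f zero + ∑ (λ y → f (suc y)) ≡⟨ cong (f zero +_) (sum-cong-≗ (λ y → vanish (suc y) (λ ()))) ⟩
  f zero + ∑ {n} (λ _ → 0)     ≡⟨ cong (f zero +_) (trans (∑-const n 0) (*-zeroʳ n)) ⟩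
  f zero + 0                   ≡⟨ +-identityʳ (f zero) ⟩
  f zero                       ∎
  where open ≡-Reasoning
∑-only {suc n} f (suc z) vanish = begin
  f zero + ∑ (λ y → f (suc y)) ≡⟨ cong (_+ ∑ (λ y → f (suc y))) (vanish zero (λ ())) ⟩
  ∑ (λ y → f (suc y))          ≡⟨ ∑-only (λ y → f (suc y)) z (λ y y≢z → vanish (suc y) (λ e → y≢z (Finₚ.suc-injective e))) ⟩
  f (suc z)                    ∎
  where open ≡-Reasoning

∑-delta : ∀ {n} (f : Fin n → ℕ) z → ∑ (λ y → f y * 𝟙 ⌊ z ≟ y ⌋) ≡ f z
∑-delta f z = trans (∑-only _ z vanish) at-z
  where
  vanish : ∀ y → ¬ y ≡ z → f y * 𝟙 ⌊ z ≟ y ⌋ ≡ 0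
  vanish y y≢z with z ≟ y
  ... | yes z≡y = ⊥-elim (y≢z (sym z≡y))
  ... | no  _   = *-zeroʳ (f y)
  at-z : f z * 𝟙 ⌊ z ≟ z ⌋ ≡ f z
  at-z with z ≟ z
  ... | yes _   = *-identityʳ (f z)
  ... | no  z≢z = ⊥-elim (z≢z refl)

count : ∀ {n} → (Fin n → Bool) → ℕ
count f = ∑ (λ i → 𝟙 (f i))

count≤n : ∀ {n} (f : Fin n → Bool) → count f ≤ n
count≤n {n} f = ≤-trans (∑-mono (λ i → 𝟙≤1 (f i))) (≤-reflexive (trans (∑-const n 1) (*-identityʳ n)))

count-not : ∀ {n} (f : Fin n → Bool) → count (λ i → not (f i)) + count f ≡ n
count-not {n} f = begin
  count (λ i → not (f i)) + count f  ≡⟨ ∑-distrib-+ (λ i → 𝟙 (not (f i))) (λ i → 𝟙 (f i)) ⟨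
  ∑ (λ i → 𝟙 (not (f i)) + 𝟙 (f i))  ≡⟨ sum-cong-≗ (λ i → 𝟙-not (f i)) ⟩
  ∑ {n} (λ _ → 1)                    ≡⟨ trans (∑-const n 1) (*-identityʳ n) ⟩
  n                                  ∎
  where open ≡-Reasoning

count-pos : ∀ {n} (f : Fin n → Bool) → 0 < count f → ∃ λ i → T (f i)
count-pos f pos with ∑-pos (λ i → 𝟙 (f i)) pos
... | i , fi = i , 𝟙-pos fi

count-none : ∀ {n} (f : Fin n → Bool) → count f ≡ 0 → ∀ i → ¬ T (f i)
count-none f none i fi = 1+n≰n (≤-trans (≤-reflexive (sym (𝟙-T fi))) (subst (𝟙 (f i) ≤_) none (∑-point _ i)))

count-all : ∀ {n} (f : Fin n → Bool) → n ≤ count f → ∀ i → T (f i)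
count-all {n} f all i = 𝟙-pos (subst (0 <_) (sym (∑-tight (λ i → 𝟙 (f i)) (λ _ → 1) (λ i → 𝟙≤1 (f i))
  (≤-trans (≤-reflexive (trans (∑-const n 1) (*-identityʳ n))) all) i)) (s≤s z≤n))

count-≥2 : ∀ {n} (f : Fin n → Bool) i j → ¬ i ≡ j → T (f i) → T (f j) → 2 ≤ count f
count-≥2 f i j i≢j fi fj = subst (_≤ count f) (cong₂ _+_ (𝟙-T fi) (𝟙-T fj)) (∑-pair (λ k → 𝟙 (f k)) i j i≢j)

count-two : ∀ {n} (f : Fin n → Bool) → 2 ≤ count f → ∃ λ i → ∃ λ j → ¬ i ≡ j × T (f i) × T (f j)
count-two {suc n} f two with f zero in eq
... | true  with count-pos (λ i → f (suc i)) (+-cancelˡ-≤ 1 _ _ two)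
...   | j , fj = zero , suc j , (λ ()) , subst T (sym eq) _ , fj
count-two {suc n} f two | false with count-two (λ i → f (suc i)) two
...   | i , j , i≢j , fi , fj = suc i , suc j , (λ e → i≢j (Finₚ.suc-injective e)) , fi , fj

count-≤1 : ∀ {n} (f : Fin n → Bool) → (∀ i j → ¬ i ≡ j → T (f i) → ¬ T (f j)) → count f ≤ 1
count-≤1 f excl with 2 ≤? count f
... | yes two = let (i , j , i≢j , fi , fj) = count-two f two in ⊥-elim (excl i j i≢j fi fj)
... | no  ¬two = ≤-pred (≰⇒> ¬two)

count-≟ : ∀ {n} (z : Fin n) → count (λ y → ⌊ z ≟ y ⌋) ≡ 1
count-≟ z = trans (sum-cong-≗ (λ y → sym (*-identityˡ (𝟙 ⌊ z ≟ y ⌋)))) (∑-delta (λ _ → 1) z)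

∈⇒T : ∀ {n} {A : Subset n} {x} → x ∈ A → T (lookup A x)
∈⇒T x∈A = subst T (sym (Vecₚ.[]=⇒lookup x∈A)) _

T⇒∈ : ∀ {n} {A : Subset n} {x} → T (lookup A x) → x ∈ A
T⇒∈ {A = A} {x} t = Vecₚ.lookup⇒[]= x A (Equivalence.to T-≡ t)

∣∣-count : ∀ {n} (A : Subset n) → ∣ A ∣ ≡ count (lookup A)
∣∣-count []          = refl
∣∣-count (true ∷ A)  = cong suc (∣∣-count A)
∣∣-count (false ∷ A) = ∣∣-count A

∈-tabulate⁻ : ∀ {n} (f : Fin n → Bool) {x} → x ∈ tabulate f → T (f x)
∈-tabulate⁻ f {x} x∈ = subst T (Vecₚ.lookup∘tabulate f x) (∈⇒T x∈)

∈-tabulate⁺ : ∀ {n} (f : Fin n → Bool) {x} → T (f x) → x ∈ tabulate f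
∈-tabulate⁺ f {x} fx = T⇒∈ (subst T (sym (Vecₚ.lookup∘tabulate f x)) fx)

∣tabulate∣ : ∀ {n} (f : Fin n → Bool) → ∣ tabulate f ∣ ≡ count f
∣tabulate∣ f = trans (∣∣-count (tabulate f)) (sum-cong-≗ (λ x → cong 𝟙 (Vecₚ.lookup∘tabulate f x)))

∈─⇒∉ : ∀ {n} (A B : Subset n) {x} → x ∈ A ─ B → x ∉ B
∈─⇒∉ (a ∷ A) (b ∷ B) (there x∈) (there x∈B) = ∈─⇒∉ A B x∈ x∈B

∈∁⇔∉ : ∀ {n} {A : Subset n} {x} → x ∈ ∁ A ⇔ x ∉ A
∈∁⇔∉ = mk⇔ Subₚ.x∈∁p⇒x∉p Subₚ.x∉p⇒x∈∁p

∈pairˡ : ∀ {n} (a b : Fin n) → a ∈ pair a b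
∈pairˡ a b = Subₚ.x∈p∪q⁺ (inj₁ (Subₚ.x∈⁅x⁆ a))

∈pairʳ : ∀ {n} (a b : Fin n) → b ∈ pair a b
∈pairʳ a b = Subₚ.x∈p∪q⁺ (inj₂ (Subₚ.x∈⁅x⁆ b))

∈pair⁻ : ∀ {n} {a b x : Fin n} → x ∈ pair a b → x ≡ a ⊎ x ≡ b
∈pair⁻ {a = a} {b} x∈ with Subₚ.x∈p∪q⁻ ⁅ a ⁆ ⁅ b ⁆ x∈
... | inj₁ x∈a = inj₁ (Subₚ.x∈⁅y⁆⇒x≡y a x∈a)
... | inj₂ x∈b = inj₂ (Subₚ.x∈⁅y⁆⇒x≡y b x∈b)

pair-comm : ∀ {n} (a b : Fin n) → pair a b ≡ pair b a
pair-comm a b = Subₚ.∪-comm ⁅ a ⁆ ⁅ b ⁆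

pair⊆ : ∀ {n} {A : Subset n} {a b} → a ∈ A → b ∈ A → pair a b ⊆ A
pair⊆ a∈ b∈ x∈ with ∈pair⁻ x∈
... | inj₁ refl = a∈
... | inj₂ refl = b∈

anyFin⁻ : ∀ {n} (f : Fin n → Bool) → T (anyFin f) → ∃ λ x → T (f x)
anyFin⁻ {suc n} f t with f zero in eq
... | true  = zero , subst T (sym eq) _
... | false with anyFin⁻ (λ x → f (suc x)) t
...   | x , fx = suc x , fx

anyFin⁺ : ∀ {n} (f : Fin n → Bool) x → T (f x) → T (anyFin f)
anyFin⁺ f zero    fx with f zero
... | true = _
anyFin⁺ f (suc x) fx with f zero
... | true  = _
... | false = anyFin⁺ (λ y → f (suc y)) x fx

∈image⁻ : ∀ {n} (δ : Fin n → Fin n) (A : Subset n) {y} → y ∈ image δ A → ∃ λ x → x ∈ A × δ x ≡ y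
∈image⁻ δ A y∈ with anyFin⁻ _ (∈-tabulate⁻ _ y∈)
... | x , t with Equivalence.to (T-∧ {lookup A x}) t
...   | x∈A , δx≡y = x , T⇒∈ x∈A , toWitness δx≡y

∈image⁺ : ∀ {n} (δ : Fin n → Fin n) (A : Subset n) {x} → x ∈ A → δ x ∈ image δ A
∈image⁺ δ A {x} x∈ = ∈-tabulate⁺ _ (anyFin⁺ _ x (Equivalence.from T-∧ (∈⇒T x∈ , fromWitness refl)))

image-pair : ∀ {n} (δ : Fin n → Fin n) a b → image δ (pair a b) ≡ pair (δ a) (δ b)
image-pair δ a b = Subₚ.⊆-antisym ⊆pair (pair⊆ (∈image⁺ δ _ (∈pairˡ a b)) (∈image⁺ δ _ (∈pairʳ a b)))
  where
  ⊆pair : image δ (pair a b) ⊆ pair (δ a) (δ b)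
  ⊆pair y∈ with ∈image⁻ δ (pair a b) y∈
  ... | x , x∈ , refl with ∈pair⁻ x∈
  ...   | inj₁ refl = ∈pairˡ (δ a) (δ b)
  ...   | inj₂ refl = ∈pairʳ (δ a) (δ b)

module _ {n} (𝔭 : Family n) (A : Subset n) where

  ∈N⁺ˡ : ∀ {y} → y ∈ A → y ∈ N 𝔭 A
  ∈N⁺ˡ y∈ = ∈-tabulate⁺ _ (Equivalence.from T-∨ (inj₁ (∈⇒T y∈)))

  ∈N⁺ʳ : ∀ {a y} → a ∈ A → pair a y ∉𝔭 𝔭 → y ∈ N 𝔭 A
  ∈N⁺ʳ {a} a∈ ay∉ = ∈-tabulate⁺ _ (Equivalence.from T-∨
    (inj₂ (anyFin⁺ _ a (Equivalence.from T-∧ (∈⇒T a∈ , not⁺ ay∉)))))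

  ∈N⁻ : ∀ {y} → y ∈ N 𝔭 A → y ∈ A ⊎ ∃ λ a → a ∈ A × pair a y ∉𝔭 𝔭
  ∈N⁻ {y} y∈ with Equivalence.to T-∨ (∈-tabulate⁻ _ y∈)
  ... | inj₁ y∈A = inj₁ (T⇒∈ y∈A)
  ... | inj₂ t   with anyFin⁻ _ t
  ...   | a , ta with Equivalence.to (T-∧ {lookup A a}) ta
  ...     | a∈ , ay∉ = inj₂ (a , T⇒∈ a∈ , not⁻ ay∉)

⊆⇒⊂⊎≡ : ∀ {n} {A B : Subset n} → A ⊆ B → A ⊂ B ⊎ A ≡ B
⊆⇒⊂⊎≡ {A = A} {B} A⊆B with Finₚ.any? (λ x → x Subₚ.∈? B ×-dec ¬? (x Subₚ.∈? A))
... | yes (x , x∈B , x∉A) = inj₁ (A⊆B , x , x∈B , x∉A)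
... | no  none = inj₂ (Subₚ.⊆-antisym A⊆B
      (λ {x} x∈B → decidable-stable (x Subₚ.∈? A) (λ x∉A → none (x , x∈B , x∉A))))

⊆⁅⁆ : ∀ {n} (A : Subset n) → Fin n → ∣ A ∣ < 2 → ∃ λ x → A ⊆ ⁅ x ⁆
⊆⁅⁆ A z small with Subₚ.nonempty? A
... | no  empty   = z , λ {y} y∈ → ⊥-elim (empty (y , y∈))
... | yes (x , x∈) = x , y∈⁅x⁆
  where
  y∈⁅x⁆ : ∀ {y} → y ∈ A → y ∈ ⁅ x ⁆
  y∈⁅x⁆ {y} y∈ with y ≟ x
  ... | yes refl = Subₚ.x∈⁅x⁆ x
  ... | no  y≢x  = ⊥-elim (<⇒≱ small (subst (2 ≤_) (sym (∣∣-count A))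
                    (count-≥2 (lookup A) y x y≢x (∈⇒T y∈) (∈⇒T x∈))))

∈-allSubsets : ∀ {k} (A : Subset k) → A Listₘ.∈ allSubsets k
∈-allSubsets []          = Any.here refl
∈-allSubsets (true ∷ A)  = ∈ₚ.∈-++⁺ˡ (∈ₚ.∈-map⁺ (true ∷_) (∈-allSubsets A))
∈-allSubsets {suc k} (false ∷ A) =
  ∈ₚ.∈-++⁺ʳ (List.map (true ∷_) (allSubsets k)) (∈ₚ.∈-map⁺ (false ∷_) (∈-allSubsets A))

module Independence {n} (𝔭 : Family n) (dc : DownClosed 𝔭) (pc : PairwiseClosed 𝔭)
                    (si : SingletonsIn 𝔭) where

  Indep : Fin n → Fin n → Set
  Indep x y = pair x y ∈𝔭 𝔭

  PairwiseIndep : Subset n → Set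
  PairwiseIndep A = ∀ {x y} → x ∈ A → y ∈ A → Indep x y

  indep-sym : ∀ {x y} → Indep x y → Indep y x
  indep-sym {x} {y} = subst (_∈𝔭 𝔭) (pair-comm x y)

  -- 𝔭 is closed under subsets (hypothesis (a) only speaks of proper ones).
  ⊆-closed : ∀ {A B} → B ∈𝔭 𝔭 → A ⊆ B → A ∈𝔭 𝔭
  ⊆-closed {A} {B} B∈ A⊆B with ⊆⇒⊂⊎≡ A⊆B
  ... | inj₁ A⊂B = dc B A B∈ A⊂B
  ... | inj₂ refl = B∈

  ∈𝔭⇒pairwise : ∀ {A} → A ∈𝔭 𝔭 → PairwiseIndep A
  ∈𝔭⇒pairwise A∈ x∈ y∈ = ⊆-closed A∈ (pair⊆ x∈ y∈)

  -- Conversely a pairwise independent set is in 𝔭: by (b) if it has two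
  -- elements, and otherwise it lies in a singleton, which is in 𝔭 by (c).
  pairwise⇒∈𝔭 : Fin n → ∀ {A} → PairwiseIndep A → A ∈𝔭 𝔭
  pairwise⇒∈𝔭 z {A} ind with 2 ≤? ∣ A ∣
  ... | yes two   = pc A two (λ x y x∈ y∈ _ → ind x∈ y∈)
  ... | no  ¬two  = let (x , A⊆x) = ⊆⁅⁆ A z (≰⇒> ¬two) in ⊆-closed (si x) A⊆x

  private
    largest : List (Subset n) → ℕ
    largest = List.foldr (λ B acc → if 𝔭 B then ∣ B ∣ ⊔ acc else acc) 0

    largest-ub : ∀ L {B} → B Listₘ.∈ L → B ∈𝔭 𝔭 → ∣ B ∣ ≤ largest L
    largest-ub (C ∷ L) (Any.here refl) B∈ with 𝔭 C
    ... | true = m≤m⊔n _ _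
    largest-ub (C ∷ L) (Any.there B∈L) B∈ with 𝔭 C
    ... | true  = ≤-trans (largest-ub L B∈L B∈) (m≤n⊔m _ _)
    ... | false = largest-ub L B∈L B∈

    largest-attained : ∀ L → largest L ≡ 0 ⊎ ∃ λ B → B ∈𝔭 𝔭 × ∣ B ∣ ≡ largest L
    largest-attained []      = inj₁ refl
    largest-attained (C ∷ L) with 𝔭 C in eq
    ... | false = largest-attained L
    ... | true  with ⊔-sel ∣ C ∣ (largest L) | largest-attained L
    ...   | inj₁ e | _                   = inj₂ (C , subst T (sym eq) _ , sym e)
    ...   | inj₂ e | inj₁ z              = inj₁ (trans e z)
    ...   | inj₂ e | inj₂ (B , B∈ , eB) = inj₂ (B , B∈ , trans eB (sym e))

  α-ub : ∀ {B} → B ∈𝔭 𝔭 → ∣ B ∣ ≤ α 𝔭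
  α-ub {B} = largest-ub (allSubsets n) (∈-allSubsets B)

  α-pos : Fin n → 1 ≤ α 𝔭
  α-pos z = subst (_≤ α 𝔭) (Subₚ.∣⁅x⁆∣≡1 z) (α-ub (si z))

  α-attained : Fin n → ∃ λ J → J ∈𝔭 𝔭 × ∣ J ∣ ≡ α 𝔭
  α-attained z with largest-attained (allSubsets n)
  ... | inj₂ J = J
  ... | inj₁ α≡0 = ⊥-elim (1+n≰n (≤-trans (α-pos z) (≤-reflexive α≡0)))

module _ {A : Set} where

  ∑ᴸ : List A → (A → ℕ) → ℕ
  ∑ᴸ []       f = 0
  ∑ᴸ (v ∷ vs) f = f v + ∑ᴸ vs f

  ∑ᴸ-cong : ∀ vs {f g : A → ℕ} → (∀ v → f v ≡ g v) → ∑ᴸ vs f ≡ ∑ᴸ vs g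
  ∑ᴸ-cong []       eq = refl
  ∑ᴸ-cong (v ∷ vs) eq = cong₂ _+_ (eq v) (∑ᴸ-cong vs eq)

  ∑ᴸ-mono : ∀ vs {f g : A → ℕ} → (∀ {v} → v Listₘ.∈ vs → f v ≤ g v) → ∑ᴸ vs f ≤ ∑ᴸ vs g
  ∑ᴸ-mono []       le = z≤n
  ∑ᴸ-mono (v ∷ vs) le = +-mono-≤ (le (Any.here refl)) (∑ᴸ-mono vs (λ v∈ → le (Any.there v∈)))

  ∑ᴸ-point : ∀ vs (f : A → ℕ) {v} → v Listₘ.∈ vs → f v ≤ ∑ᴸ vs f
  ∑ᴸ-point (w ∷ vs) f (Any.here refl) = m≤m+n _ _
  ∑ᴸ-point (w ∷ vs) f (Any.there v∈)  = ≤-trans (∑ᴸ-point vs f v∈) (m≤n+m _ _)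

  ∑ᴸ-distrib-+ : ∀ vs (f g : A → ℕ) → ∑ᴸ vs (λ v → f v + g v) ≡ ∑ᴸ vs f + ∑ᴸ vs g
  ∑ᴸ-distrib-+ []       f g = refl
  ∑ᴸ-distrib-+ (v ∷ vs) f g = trans (cong (f v + g v +_) (∑ᴸ-distrib-+ vs f g))
                                    (+-+-comm (f v) (g v) (∑ᴸ vs f) (∑ᴸ vs g))
    where
    +-+-comm : ∀ a b c d → a + b + (c + d) ≡ a + c + (b + d)
    +-+-comm = solve-∀

  ∑ᴸ-*ˡ : ∀ vs c (f : A → ℕ) → ∑ᴸ vs (λ v → c * f v) ≡ c * ∑ᴸ vs f
  ∑ᴸ-*ˡ []       c f = sym (*-zeroʳ c)
  ∑ᴸ-*ˡ (v ∷ vs) c f = trans (cong (c * f v +_) (∑ᴸ-*ˡ vs c f)) (sym (*-distribˡ-+ c (f v) _))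

  ∑ᴸ-const : ∀ vs c → ∑ᴸ vs (λ _ → c) ≡ c * ∑ᴸ vs (λ _ → 1)
  ∑ᴸ-const vs c = trans (∑ᴸ-cong vs (λ _ → sym (*-identityʳ c))) (∑ᴸ-*ˡ vs c (λ _ → 1))

  ∑ᴸ-∑-comm : ∀ {n} vs (f : A → Fin n → ℕ) → ∑ᴸ vs (λ v → ∑ (f v)) ≡ ∑ (λ x → ∑ᴸ vs (λ v → f v x))
  ∑ᴸ-∑-comm {n} []       f = sym (trans (∑-const n 0) (*-zeroʳ n))
  ∑ᴸ-∑-comm     (v ∷ vs) f = trans (cong (∑ (f v) +_) (∑ᴸ-∑-comm vs f))
                                   (sym (∑-distrib-+ (f v) (λ x → ∑ᴸ vs (λ w → f w x))))

  ∑ᴸ-𝟙 : ∀ {P : A → Set} (P? : Decidable P) vs → ∑ᴸ vs (λ v → 𝟙 ⌊ P? v ⌋) ≡ List.length (List.filter P? vs)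
  ∑ᴸ-𝟙 P? []       = refl
  ∑ᴸ-𝟙 P? (v ∷ vs) with P? v
  ... | yes _ = cong suc (∑ᴸ-𝟙 P? vs)
  ... | no  _ = ∑ᴸ-𝟙 P? vs

  unique-length-≤ : ∀ {xs ys : List A} → Unique xs → (∀ {x} → x Listₘ.∈ xs → x Listₘ.∈ ys)
                  → List.length xs ≤ List.length ys
  unique-length-≤ {[]}     _          _   = z≤n
  unique-length-≤ {x ∷ xs} {ys} (x∉xs ∷ u) sub with ∈ₚ.∈-∃++ (sub (Any.here refl))
  ... | ys₁ , ys₂ , refl = ≤-trans (s≤s (unique-length-≤ u sub′)) (≤-reflexive (sym (Listₚ.length-++-sucʳ ys₁ x ys₂)))
    where
    sub′ : ∀ {y} → y Listₘ.∈ xs → y Listₘ.∈ (ys₁ List.++ ys₂)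
    sub′ {y} y∈ with ∈ₚ.∈-++⁻ ys₁ (sub (Any.there y∈))
    ... | inj₁ y∈₁               = ∈ₚ.∈-++⁺ˡ y∈₁
    ... | inj₂ (Any.here refl)   = ⊥-elim (All.lookup x∉xs y∈ refl)
    ... | inj₂ (Any.there y∈₂)   = ∈ₚ.∈-++⁺ʳ ys₁ y∈₂

  count-by-injection : ∀ {P Q : A → Set} (P? : Decidable P) (Q? : Decidable Q) {L} → Unique L
    → (φ : A → A) → (∀ {u v} → φ u ≡ φ v → u ≡ v)
    → (∀ {v} → v Listₘ.∈ L → P v → φ v Listₘ.∈ L × Q (φ v))
    → List.length (List.filter P? L) ≤ List.length (List.filter Q? L)
  count-by-injection P? Q? {L} u φ φ-inj maps = begin
    List.length (List.filter P? L)                ≡⟨ Listₚ.length-map φ (List.filter P? L) ⟨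
    List.length (List.map φ (List.filter P? L))   ≤⟨ unique-length-≤ (Uniqueₚ.map⁺ φ-inj (Uniqueₚ.filter⁺ P? u)) into ⟩
    List.length (List.filter Q? L)                ∎
    where
    open ≤-Reasoning
    into : ∀ {w} → w Listₘ.∈ List.map φ (List.filter P? L) → w Listₘ.∈ List.filter Q? L
    into w∈ with ∈ₚ.∈-map⁻ φ w∈
    ... | v , v∈ , refl with ∈ₚ.∈-filter⁻ P? {xs = L} v∈
    ...   | v∈L , Pv = let (φv∈ , Qφv) = maps v∈L Pv in ∈ₚ.∈-filter⁺ Q? φv∈ Qφv

vec-ext : ∀ {A : Set} {k} {u v : Vec A k} → (∀ x → lookup u x ≡ lookup v x) → u ≡ v
vec-ext {u = u} {v} eq =
  trans (sym (Vecₚ.tabulate∘lookup u)) (trans (Vecₚ.tabulate-cong eq) (Vecₚ.tabulate∘lookup v))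

allVecs : ∀ n k → List (Vec (Fin n) k)
allVecs n zero    = [] ∷ []
allVecs n (suc k) = List.cartesianProductWith _∷_ (List.allFin n) (allVecs n k)

∈-allVecs : ∀ {n k} (v : Vec (Fin n) k) → v Listₘ.∈ allVecs n k
∈-allVecs []      = Any.here refl
∈-allVecs (x ∷ v) = ∈ₚ.∈-cartesianProductWith⁺ _∷_ (∈ₚ.∈-allFin x) (∈-allVecs v)

allVecs-unique : ∀ n k → Unique (allVecs n k)
allVecs-unique n zero    = All.[] ∷ []
allVecs-unique n (suc k) =
  Uniqueₚ.cartesianProductWith⁺ _∷_ Vecₚ.∷-injective (Uniqueₚ.allFin⁺ n) (allVecs-unique n k)

-- Endomorphisms of a symmetric family and the averaging identity.

module Endomorphisms {n} (𝔭 : Family n) (Γ : Group 0ℓ 0ℓ) (sym𝔭 : SymmetricVia Γ 𝔭) where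

  open SymmetricVia sym𝔭
  open Group Γ using (Carrier; _⁻¹; inverseˡ)

  act-inverse : ∀ g x → act (g ⁻¹) (act g x) ≡ x
  act-inverse g x = trans (sym (act-∙ (g ⁻¹) g x)) (trans (act-cong (inverseˡ g) x) (act-ε x))

  act-injective : ∀ g {x y} → act g x ≡ act g y → x ≡ y
  act-injective g {x} {y} e = trans (sym (act-inverse g x)) (trans (cong (act (g ⁻¹)) e) (act-inverse g y))

  -- Since g⁻¹ preserves 𝔭, the action of g also reflects 𝔭-pairs.
  act-reflects : ∀ g a b → pair (act g a) (act g b) ∈𝔭 𝔭 → pair a b ∈𝔭 𝔭
  act-reflects g a b gab∈ = subst (_∈𝔭 𝔭) back (preserves (g ⁻¹) _ gab∈)
    where
    back : image (act (g ⁻¹)) (pair (act g a) (act g b)) ≡ pair a b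
    back = trans (image-pair (act (g ⁻¹)) (act g a) (act g b))
                 (cong₂ pair (act-inverse g a) (act-inverse g b))

  -- Maps X → X, as vectors of values.  An endomorphism (of the graph whose
  -- edges are the pairs outside 𝔭) is a map reflecting 𝔭-pairs.
  Map : Set
  Map = Vec (Fin n) n

  IsEndo : Map → Set
  IsEndo v = ∀ a b → pair (lookup v a) (lookup v b) ∈𝔭 𝔭 → pair a b ∈𝔭 𝔭

  isEndo? : Decidable IsEndo
  isEndo? v = Finₚ.all? λ a → Finₚ.all? λ b → T? _ →-dec T? _

  endos : List Map
  endos = List.filter isEndo? (allVecs n n)

  ∈endos⁺ : ∀ {v} → IsEndo v → v Listₘ.∈ endos
  ∈endos⁺ {v} endo = ∈ₚ.∈-filter⁺ isEndo? (∈-allVecs v) endo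

  ∈endos⁻ : ∀ {v} → v Listₘ.∈ endos → IsEndo v
  ∈endos⁻ v∈ = proj₂ (∈ₚ.∈-filter⁻ isEndo? {xs = allVecs n n} v∈)

  size : ℕ
  size = ∑ᴸ endos (λ _ → 1)

  size-pos : 1 ≤ size
  size-pos = ∑ᴸ-point endos (λ _ → 1) (∈endos⁺ {tabulate (λ x → x)} id-endo)
    where
    id-endo : IsEndo (tabulate (λ x → x))
    id-endo a b = subst₂ (λ a′ b′ → pair a′ b′ ∈𝔭 𝔭) (Vecₚ.lookup∘tabulate (λ x → x) a) (Vecₚ.lookup∘tabulate (λ x → x) b)

  shift : Carrier → Map → Map
  shift g v = Vec.map (act g) v

  shift-endo : ∀ g {v} → IsEndo v → IsEndo (shift g v)
  shift-endo g {v} endo a b gvab∈ = endo a b (act-reflects g _ _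
    (subst₂ (λ a′ b′ → pair a′ b′ ∈𝔭 𝔭) (Vecₚ.lookup-map a (act g) v) (Vecₚ.lookup-map b (act g) v) gvab∈))

  shift-injective : ∀ g {u v} → shift g u ≡ shift g v → u ≡ v
  shift-injective g {u} {v} e = vec-ext λ x → act-injective g
    (trans (sym (Vecₚ.lookup-map x (act g) u)) (trans (cong (λ w → lookup w x) e) (Vecₚ.lookup-map x (act g) v)))

  fibre : Fin n → Fin n → ℕ
  fibre x y = ∑ᴸ endos (λ v → 𝟙 ⌊ lookup v x ≟ y ⌋)

  -- Composing with a group element moving y to y′ injects one fibre into the other.
  fibre-≤ : ∀ x y y′ → fibre x y ≤ fibre x y′
  fibre-≤ x y y′ with transitive y y′
  ... | g , gy≡y′ = begin
    fibre x y                                  ≡⟨ ∑ᴸ-𝟙 (λ v → lookup v x ≟ y) endos ⟩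
    List.length (List.filter (λ v → lookup v x ≟ y) endos)
      ≤⟨ count-by-injection (λ v → lookup v x ≟ y) (λ v → lookup v x ≟ y′)
           (Uniqueₚ.filter⁺ isEndo? (allVecs-unique n n)) (shift g) (shift-injective g) moves ⟩
    List.length (List.filter (λ v → lookup v x ≟ y′) endos) ≡⟨ ∑ᴸ-𝟙 (λ v → lookup v x ≟ y′) endos ⟨
    fibre x y′                                 ∎
    where
    open ≤-Reasoning
    moves : ∀ {v} → v Listₘ.∈ endos → lookup v x ≡ y → shift g v Listₘ.∈ endos × lookup (shift g v) x ≡ y′
    moves {v} v∈ vx≡y = ∈endos⁺ {shift g v} (shift-endo g {v} (∈endos⁻ v∈))
                      , trans (Vecₚ.lookup-map x (act g) v) (trans (cong (act g) vx≡y) gy≡y′)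

  fibre-total : ∀ x → ∑ (fibre x) ≡ size
  fibre-total x = trans (sym (∑ᴸ-∑-comm endos (λ v y → 𝟙 ⌊ lookup v x ≟ y ⌋)))
                        (∑ᴸ-cong endos (λ v → count-≟ (lookup v x)))

  fibre-uniform : ∀ x y → n * fibre x y ≡ size
  fibre-uniform x y = begin
    n * fibre x y           ≡⟨ ∑-const n (fibre x y) ⟨
    ∑ {n} (λ _ → fibre x y) ≡⟨ sum-cong-≗ (λ y′ → ≤-antisym (fibre-≤ x y y′) (fibre-≤ x y′ y)) ⟩
    ∑ (fibre x)             ≡⟨ fibre-total x ⟩
    size                    ∎
    where open ≡-Reasoning

  into-uniform : ∀ (J : Fin n → Bool) x → n * ∑ᴸ endos (λ v → 𝟙 (J (lookup v x))) ≡ count J * size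
  into-uniform J x = begin
    n * ∑ᴸ endos (λ v → 𝟙 (J (lookup v x)))
      ≡⟨ cong (n *_) (∑ᴸ-cong endos (λ v → sym (∑-delta (λ y → 𝟙 (J y)) (lookup v x)))) ⟩
    n * ∑ᴸ endos (λ v → ∑ (λ y → 𝟙 (J y) * 𝟙 ⌊ lookup v x ≟ y ⌋))
      ≡⟨ cong (n *_) (∑ᴸ-∑-comm endos (λ v y → 𝟙 (J y) * 𝟙 ⌊ lookup v x ≟ y ⌋)) ⟩
    n * ∑ (λ y → ∑ᴸ endos (λ v → 𝟙 (J y) * 𝟙 ⌊ lookup v x ≟ y ⌋))
      ≡⟨ cong (n *_) (sum-cong-≗ (λ y → ∑ᴸ-*ˡ endos (𝟙 (J y)) _)) ⟩
    n * ∑ (λ y → 𝟙 (J y) * fibre x y)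
      ≡⟨ *-distribˡ-sum n (λ y → 𝟙 (J y) * fibre x y) ⟩
    ∑ (λ y → n * (𝟙 (J y) * fibre x y))
      ≡⟨ sum-cong-≗ (λ y → trans (*-left-comm n (𝟙 (J y)) (fibre x y)) (cong (𝟙 (J y) *_) (fibre-uniform x y))) ⟩
    ∑ (λ y → 𝟙 (J y) * size)
      ≡⟨ ∑-*ʳ (λ y → 𝟙 (J y)) size ⟩
    count J * size ∎
    where open ≡-Reasoning

  averaging : ∀ (H J : Fin n → Bool)
            → n * ∑ᴸ endos (λ v → count (λ x → H x ∧ J (lookup v x))) ≡ count H * (count J * size)
  averaging H J = begin
    n * ∑ᴸ endos (λ v → ∑ (λ x → 𝟙 (H x ∧ J (lookup v x))))
      ≡⟨ cong (n *_) (∑ᴸ-∑-comm endos (λ v x → 𝟙 (H x ∧ J (lookup v x)))) ⟩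
    n * ∑ (λ x → ∑ᴸ endos (λ v → 𝟙 (H x ∧ J (lookup v x))))
      ≡⟨ cong (n *_) (sum-cong-≗ (λ x → trans (∑ᴸ-cong endos (λ v → 𝟙-∧ (H x) _)) (∑ᴸ-*ˡ endos (𝟙 (H x)) _))) ⟩
    n * ∑ (λ x → 𝟙 (H x) * ∑ᴸ endos (λ v → 𝟙 (J (lookup v x))))
      ≡⟨ *-distribˡ-sum n (λ x → 𝟙 (H x) * ∑ᴸ endos (λ v → 𝟙 (J (lookup v x)))) ⟩
    ∑ (λ x → n * (𝟙 (H x) * ∑ᴸ endos (λ v → 𝟙 (J (lookup v x)))))
      ≡⟨ sum-cong-≗ (λ x → trans (*-left-comm n (𝟙 (H x)) _) (cong (𝟙 (H x) *_) (into-uniform J x))) ⟩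
    ∑ (λ x → 𝟙 (H x) * (count J * size))
      ≡⟨ ∑-*ʳ (λ x → 𝟙 (H x)) (count J * size) ⟩
    count H * (count J * size) ∎
    where open ≡-Reasoning

-- The ratio bound: |S| / |N[S]| ≤ α / |X| for every S ∈ 𝔭.

-- The pointwise inequality behind it, for a point with s ⇒ ν
-- (s: in S, ν: in N[S], j: mapped into J).
𝟙-split : ∀ s ν → (T s → T ν) → ∀ j → 𝟙 j + 𝟙 s ≤ 𝟙 (ν ∧ j) + 𝟙 ((not ν ∧ j) ∨ s)
𝟙-split true  true  _ j     = ≤-refl
𝟙-split true  false s⇒ν _   = ⊥-elim (s⇒ν _)
𝟙-split false true  _ _     = ≤-refl
𝟙-split false false _ true  = ≤-refl
𝟙-split false false _ false = ≤-refl

module RatioBound {n} (𝔭 : Family n) (dc : DownClosed 𝔭) (pc : PairwiseClosed 𝔭) (si : SingletonsIn 𝔭)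
                  (Γ : Group 0ℓ 0ℓ) (sym𝔭 : SymmetricVia Γ 𝔭) (x₀ : Fin n) where

  open Independence 𝔭 dc pc si
  open Endomorphisms 𝔭 Γ sym𝔭

  module _ (S : Subset n) (S∈ : S ∈𝔭 𝔭) where

    J : Subset n
    J = proj₁ (α-attained x₀)

    ∣J∣≡α : count (lookup J) ≡ α 𝔭
    ∣J∣≡α = trans (sym (∣∣-count J)) (proj₂ (proj₂ (α-attained x₀)))

    outside-indep : ∀ {a x} → x ∉ N 𝔭 S → a ∈ S → Indep a x
    outside-indep x∉ a∈ = decidable-stable (T? _) (λ ax∉ → x∉ (∈N⁺ʳ 𝔭 S a∈ ax∉))

    inK : Map → Fin n → Bool
    inK v x = (not (lookup (N 𝔭 S) x) ∧ lookup J (lookup v x)) ∨ lookup S x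

    K : Map → Subset n
    K v = tabulate (inK v)

    ∈K⁻ : ∀ v {x} → x ∈ K v → (x ∉ N 𝔭 S × lookup v x ∈ J) ⊎ x ∈ S
    ∈K⁻ v {x} x∈ with Equivalence.to T-∨ (∈-tabulate⁻ _ x∈)
    ... | inj₂ x∈S = inj₂ (T⇒∈ x∈S)
    ... | inj₁ t   with Equivalence.to (T-∧ {not (lookup (N 𝔭 S) x)}) t
    ...   | x∉N , vx∈J = inj₁ ((λ x∈N → not⁻ x∉N (∈⇒T x∈N)) , T⇒∈ vx∈J)

    K-indep : ∀ v → IsEndo v → PairwiseIndep (K v)
    K-indep v endo {x} {y} x∈ y∈ with ∈K⁻ v x∈ | ∈K⁻ v y∈
    ... | inj₂ x∈S          | inj₂ y∈S          = ∈𝔭⇒pairwise S∈ x∈S y∈S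
    ... | inj₂ x∈S          | inj₁ (y∉N , _)    = outside-indep y∉N x∈S
    ... | inj₁ (x∉N , _)    | inj₂ y∈S          = indep-sym (outside-indep x∉N y∈S)
    ... | inj₁ (_ , vx∈J)   | inj₁ (_ , vy∈J)   = endo x y (∈𝔭⇒pairwise (proj₁ (proj₂ (α-attained x₀))) vx∈J vy∈J)

    per-endo : ∀ v → IsEndo v → count (λ x → lookup J (lookup v x)) + ∣ S ∣
                              ≤ count (λ x → lookup (N 𝔭 S) x ∧ lookup J (lookup v x)) + α 𝔭
    per-endo v endo = begin
      count Jv + ∣ S ∣                   ≡⟨ cong (count Jv +_) (∣∣-count S) ⟩
      count Jv + count (lookup S)        ≡⟨ ∑-distrib-+ (λ x → 𝟙 (Jv x)) (λ x → 𝟙 (lookup S x)) ⟨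
      ∑ (λ x → 𝟙 (Jv x) + 𝟙 (lookup S x))
        ≤⟨ ∑-mono (λ x → 𝟙-split (lookup S x) (lookup (N 𝔭 S) x) (S⊆N x) (Jv x)) ⟩
      ∑ (λ x → 𝟙 (lookup (N 𝔭 S) x ∧ Jv x) + 𝟙 (inK v x))
        ≡⟨ ∑-distrib-+ (λ x → 𝟙 (lookup (N 𝔭 S) x ∧ Jv x)) (λ x → 𝟙 (inK v x)) ⟩
      count (λ x → lookup (N 𝔭 S) x ∧ Jv x) + count (inK v)
        ≤⟨ +-monoʳ-≤ _ (subst (_≤ α 𝔭) (∣tabulate∣ (inK v)) (α-ub (pairwise⇒∈𝔭 x₀ (K-indep v endo)))) ⟩
      count (λ x → lookup (N 𝔭 S) x ∧ Jv x) + α 𝔭 ∎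
      where
      open ≤-Reasoning
      Jv : Fin n → Bool
      Jv x = lookup J (lookup v x)
      S⊆N : ∀ x → T (lookup S x) → T (lookup (N 𝔭 S) x)
      S⊆N x x∈S = ∈⇒T (∈N⁺ˡ 𝔭 S (T⇒∈ x∈S))

    -- Summing per-endo over all endomorphisms and averaging (with H = X and
    -- H = N[S]) gives n·|S|·size ≤ α·|N[S]|·size.
    ratio-bound : n * ∣ S ∣ ≤ α 𝔭 * ∣ N 𝔭 S ∣
    ratio-bound = *-cancelʳ-≤ (n * t) (a * ν) size {{>-nonZero size-pos}}
      (+-cancelʳ-≤ (n * (a * size)) _ _ (begin
        n * t * size + n * (a * size)   ≡⟨ +-comm (n * t * size) _ ⟩
        n * (a * size) + n * t * size   ≡⟨ cong₂ _+_ (sym n*hits) (*-assoc n t size) ⟩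
        n * hits + n * (t * size)       ≡⟨ *-distribˡ-+ n hits (t * size) ⟨
        n * (hits + t * size)           ≤⟨ *-monoʳ-≤ n summed ⟩
        n * (hitsN + a * size)          ≡⟨ *-distribˡ-+ n hitsN (a * size) ⟩
        n * hitsN + n * (a * size)      ≡⟨ cong (_+ n * (a * size)) n*hitsN ⟩
        a * ν * size + n * (a * size)   ∎))
      where
      open ≤-Reasoning
      a t ν : ℕ
      a = α 𝔭
      t = ∣ S ∣
      ν = ∣ N 𝔭 S ∣
      hits hitsN : ℕ
      hits  = ∑ᴸ endos (λ v → count (λ x → lookup J (lookup v x)))
      hitsN = ∑ᴸ endos (λ v → count (λ x → lookup (N 𝔭 S) x ∧ lookup J (lookup v x)))
      summed : hits + t * size ≤ hitsN + a * size
      summed = begin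
        hits + t * size  ≡⟨ cong (hits +_) (∑ᴸ-const endos t) ⟨
        hits + ∑ᴸ endos (λ _ → t) ≡⟨ ∑ᴸ-distrib-+ endos _ (λ _ → t) ⟨
        ∑ᴸ endos (λ v → count (λ x → lookup J (lookup v x)) + t)
          ≤⟨ ∑ᴸ-mono endos (λ {v} v∈ → per-endo v (∈endos⁻ {v} v∈)) ⟩
        ∑ᴸ endos (λ v → count (λ x → lookup (N 𝔭 S) x ∧ lookup J (lookup v x)) + a)
          ≡⟨ ∑ᴸ-distrib-+ endos _ (λ _ → a) ⟩
        hitsN + ∑ᴸ endos (λ _ → a) ≡⟨ cong (hitsN +_) (∑ᴸ-const endos a) ⟩
        hitsN + a * size ∎
      n*hits : n * hits ≡ n * (a * size)
      n*hits = begin-equality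
        n * hits ≡⟨ averaging (λ _ → true) (lookup J) ⟩
        count {n} (λ _ → true) * (count (lookup J) * size)
          ≡⟨ cong₂ (λ c d → c * (d * size)) (trans (∑-const n 1) (*-identityʳ n)) ∣J∣≡α ⟩
        n * (a * size) ∎
      n*hitsN : n * hitsN ≡ a * ν * size
      n*hitsN = begin-equality
        n * hitsN ≡⟨ averaging (lookup (N 𝔭 S)) (lookup J) ⟩
        count (lookup (N 𝔭 S)) * (count (lookup J) * size)
          ≡⟨ cong₂ (λ c d → c * (d * size)) (sym (∣∣-count (N 𝔭 S))) ∣J∣≡α ⟩
        ν * (a * size) ≡⟨ trans (sym (*-assoc ν a size)) (cong (_* size) (*-comm ν a)) ⟩
        a * ν * size ∎

-- Arithmetic: combining the counting bound with the ratio bound.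

+-≡0 : ∀ {x y} → x + y ≡ 0 → x ≡ 0 × y ≡ 0
+-≡0 {x} e = m+n≡0⇒m≡0 x e , m+n≡0⇒n≡0 x e

*-≡0 : ∀ {x} y → 1 ≤ x → x * y ≡ 0 → y ≡ 0
*-≡0 {suc x} y _ e = m+n≡0⇒m≡0 y e

-- The parameters: s = Σ|A_i|, t = |M|, ν = |N[M]| for the set M of points
-- covered at least twice, m families and a = α; u and w are the slacks of the
-- counting bound s + ν ≤ m·t + n and of the ratio bound n·t ≤ a·ν.
module Balance (a m n s t ν u w : ℕ) (a-pos : 1 ≤ a) (t≤a : t ≤ a)
               (counting : s + ν + u ≡ m * t + n) (ratio : n * t + w ≡ a * ν) where

  balance : a * s + (n * t + w) + a * u ≡ m * a * t + a * n
  balance = begin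
    a * s + (n * t + w) + a * u ≡⟨ cong (λ r → a * s + r + a * u) ratio ⟩
    a * s + a * ν + a * u       ≡⟨ distrib a s ν u ⟩
    a * (s + ν + u)             ≡⟨ cong (a *_) counting ⟩
    a * (m * t + n)             ≡⟨ rearrange a m t n ⟩
    m * a * t + a * n           ∎
    where
    open ≡-Reasoning
    distrib : ∀ a s ν u → a * s + a * ν + a * u ≡ a * (s + ν + u)
    distrib = solve-∀
    rearrange : ∀ a m t n → a * (m * t + n) ≡ m * a * t + a * n
    rearrange = solve-∀

  balance-below : ∀ d → m * a + d ≡ n → a * s + d * t + w + a * u ≡ a * n
  balance-below d refl = +-cancelˡ-≡ (m * a * t) _ _ (trans (shuffle a s (m * a) d t w u) balance)
    where
    shuffle : ∀ a s M d t w u → M * t + (a * s + d * t + w + a * u) ≡ a * s + ((M + d) * t + w) + a * u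
    shuffle = solve-∀

  balance-above : ∀ d e → n + d ≡ m * a → t + e ≡ a → a * s + w + a * u + d * e ≡ a * (m * a)
  balance-above d e n+d≡ma refl = +-cancelˡ-≡ (n * t) _ _ (begin
    n * t + (a′ * s + w + a′ * u + d * e) ≡⟨ shuffle₁ a′ s n t w u d e ⟩
    a′ * s + (n * t + w) + a′ * u + d * e ≡⟨ cong (_+ d * e) balance ⟩
    m * a′ * t + a′ * n + d * e          ≡⟨ cong (λ r → r * t + a′ * n + d * e) (sym n+d≡ma) ⟩
    (n + d) * t + a′ * n + d * e         ≡⟨ shuffle₂ n d t e ⟩
    n * t + (t + e) * (n + d)            ≡⟨ cong (λ r → n * t + (t + e) * r) n+d≡ma ⟩
    n * t + a′ * (m * a′)                 ∎)
    where
    open ≡-Reasoning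
    a′ = t + e
    shuffle₁ : ∀ a s n t w u d e → n * t + (a * s + w + a * u + d * e) ≡ a * s + (n * t + w) + a * u + d * e
    shuffle₁ = solve-∀
    shuffle₂ : ∀ n d t e → (n + d) * t + (t + e) * n + d * e ≡ n * t + (t + e) * (n + d)
    shuffle₂ = solve-∀

  private
    instance
      a≢0 : NonZero a
      a≢0 = >-nonZero a-pos

    assoc₄ : ∀ x y z v → x + y + z + v ≡ x + (y + z + v)
    assoc₄ = solve-∀

  below : m * a ≤ n → s ≤ n
  below ma≤n with m≤n⇒∃[o]m+o≡n ma≤n
  ... | d , ma+d≡n = *-cancelˡ-≤ a (begin
    a * s                           ≤⟨ m≤m+n (a * s) (d * t + w + a * u) ⟩
    a * s + (d * t + w + a * u)     ≡⟨ assoc₄ (a * s) (d * t) w (a * u) ⟨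
    a * s + d * t + w + a * u       ≡⟨ balance-below d ma+d≡n ⟩
    a * n                           ∎)
    where open ≤-Reasoning

  above : n ≤ m * a → s ≤ m * a
  above n≤ma with m≤n⇒∃[o]m+o≡n n≤ma | m≤n⇒∃[o]m+o≡n t≤a
  ... | d , n+d≡ma | e , t+e≡a = *-cancelˡ-≤ a (begin
    a * s                           ≤⟨ m≤m+n (a * s) (w + a * u + d * e) ⟩
    a * s + (w + a * u + d * e)     ≡⟨ assoc₄ (a * s) w (a * u) (d * e) ⟨
    a * s + w + a * u + d * e       ≡⟨ balance-above d e n+d≡ma t+e≡a ⟩
    a * (m * a)                     ∎)
    where open ≤-Reasoning

  tight-below : ∀ d → m * a + d ≡ n → s ≡ n → d * t ≡ 0 × w ≡ 0 × u ≡ 0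
  tight-below d ma+d≡n refl =
    let (dt+w≡0 , au≡0) = +-≡0 (+-cancelˡ-≡ (a * s) _ _ slack)
        (dt≡0 , w≡0)    = +-≡0 dt+w≡0
    in dt≡0 , w≡0 , *-≡0 u a-pos au≡0
    where
    slack : a * s + (d * t + w + a * u) ≡ a * s + 0
    slack = trans (sym (assoc₄ (a * s) (d * t) w (a * u)))
                  (trans (balance-below d ma+d≡n) (sym (+-identityʳ (a * s))))

  tight-above : n < m * a → s ≡ m * a → t ≡ a × w ≡ 0 × u ≡ 0
  tight-above n<ma refl with m≤n⇒∃[o]m+o≡n n<ma | m≤n⇒∃[o]m+o≡n t≤a
  ... | d , n+1+d≡ma | e , t+e≡a =
    let (w+au≡0 , de≡0) = +-≡0 (+-cancelˡ-≡ (a * s) _ _ slack)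
        (w≡0 , au≡0)    = +-≡0 w+au≡0
        e≡0             = *-≡0 {suc d} e (s≤s z≤n) de≡0
    in trans (sym (+-identityʳ t)) (trans (cong (t +_) (sym e≡0)) t+e≡a) , w≡0 , *-≡0 u a-pos au≡0
    where
    slack : a * s + (w + a * u + suc d * e) ≡ a * s + 0
    slack = trans (sym (assoc₄ (a * s) w (a * u) (suc d * e)))
                  (trans (balance-above (suc d) e (trans (+-suc n d) n+1+d≡ma) t+e≡a) (sym (+-identityʳ (a * s))))

-- Cross-𝔭-families: the core and the counting bound.

sum-tabulate : ∀ {m} (f : Fin m → ℕ) → ListAction.sum (List.tabulate f) ≡ ∑ f
sum-tabulate {zero}  f = refl
sum-tabulate {suc m} f = cong (f zero +_) (sum-tabulate (λ i → f (suc i)))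

sizeSum-by-points : ∀ {n m} (A : Fin m → Subset n) → sizeSum A ≡ ∑ (λ x → count (λ i → lookup (A i) x))
sizeSum-by-points A = begin
  sizeSum A                                  ≡⟨ sum-tabulate (λ i → ∣ A i ∣) ⟩
  ∑ (λ i → ∣ A i ∣)                          ≡⟨ sum-cong-≗ (λ i → ∣∣-count (A i)) ⟩
  ∑ (λ i → ∑ (λ x → 𝟙 (lookup (A i) x)))     ≡⟨ ∑-comm (λ i x → 𝟙 (lookup (A i) x)) ⟩
  ∑ (λ x → count (λ i → lookup (A i) x))     ∎
  where open ≡-Reasoning

module Core {n} (𝔭 : Family n) (dc : DownClosed 𝔭) (pc : PairwiseClosed 𝔭) (si : SingletonsIn 𝔭)
            {k} (A : Fin (suc k) → Subset n) (cross : CrossFamily 𝔭 A) where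

  open Independence 𝔭 dc pc si

  m : ℕ
  m = suc k

  cover : Fin n → ℕ
  cover x = count (λ i → lookup (A i) x)

  inCore : Fin n → Bool
  inCore x = ⌊ 2 ≤? cover x ⌋

  M : Subset n
  M = tabulate inCore

  core⁻ : ∀ {x} → x ∈ M → ∃ λ i → ∃ λ j → ¬ i ≡ j × x ∈ A i × x ∈ A j
  core⁻ {x} x∈ with count-two (λ i → lookup (A i) x) (toWitness (∈-tabulate⁻ inCore x∈))
  ... | i , j , i≢j , x∈i , x∈j = i , j , i≢j , T⇒∈ x∈i , T⇒∈ x∈j

  core⁺ : ∀ {x} i j → ¬ i ≡ j → x ∈ A i → x ∈ A j → x ∈ M
  core⁺ {x} i j i≢j x∈i x∈j =
    ∈-tabulate⁺ inCore (fromWitness (count-≥2 (λ l → lookup (A l) x) i j i≢j (∈⇒T x∈i) (∈⇒T x∈j)))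

  -- A core point lies in some member other than any given A_i, so it is
  -- independent of every point of every member.
  member-core-indep : ∀ {i x y} → x ∈ A i → y ∈ M → Indep x y
  member-core-indep {i} {x} {y} x∈ y∈ with core⁻ y∈
  ... | j , l , j≢l , y∈j , y∈l with i ≟ j
  ...   | yes refl = cross i l j≢l x y x∈ y∈l
  ...   | no  i≢j  = cross i j i≢j x y x∈ y∈j

  core-indep : PairwiseIndep M
  core-indep x∈ y∈ = let (i , _ , _ , x∈i , _) = core⁻ x∈ in member-core-indep x∈i y∈

  -- The profile m·[x ∈ M] + [x ∉ N[M]] bounds the cover: core points are
  -- covered at most m times, other points at most once, and not at all
  -- if they are adjacent to the core.
  inN : Fin n → Bool
  inN = lookup (N 𝔭 M)

  profile : Fin n → ℕ
  profile x = m * 𝟙 (lookup M x) + 𝟙 (not (inN x))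

  outside-core : ∀ {x} → x ∉ M → cover x ≤ 1
  outside-core {x} x∉ = count-≤1 (λ i → lookup (A i) x) (λ i j i≢j x∈i x∈j → x∉ (core⁺ i j i≢j (T⇒∈ x∈i) (T⇒∈ x∈j)))

  adjacent-uncovered : ∀ {x} → x ∉ M → x ∈ N 𝔭 M → cover x ≡ 0
  adjacent-uncovered {x} x∉ x∈N with ∈N⁻ 𝔭 M x∈N
  ... | inj₁ x∈M = ⊥-elim (x∉ x∈M)
  ... | inj₂ (a , a∈M , ax∉) = n≤0⇒n≡0 (≮⇒≥ λ pos →
          let (i , x∈i) = count-pos (λ i → lookup (A i) x) pos
          in ax∉ (indep-sym (member-core-indep (T⇒∈ x∈i) a∈M)))

  core⊆N : ∀ {x} → x ∈ M → T (inN x)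
  core⊆N x∈M = ∈⇒T (∈N⁺ˡ 𝔭 M x∈M)

  profile-core : ∀ {x} → x ∈ M → profile x ≡ m
  profile-core {x} x∈M = begin
    m * 𝟙 (lookup M x) + 𝟙 (not (inN x)) ≡⟨ cong₂ (λ p q → m * p + q) (𝟙-T (∈⇒T x∈M)) (𝟙-¬T (λ t → not⁻ t (core⊆N x∈M))) ⟩
    m * 1 + 0                            ≡⟨ trans (+-identityʳ (m * 1)) (*-identityʳ m) ⟩
    m                                    ∎
    where open ≡-Reasoning

  profile-outside : ∀ {x} → x ∉ M → profile x ≡ 𝟙 (not (inN x))
  profile-outside {x} x∉M =
    trans (cong (λ p → m * p + 𝟙 (not (inN x))) (𝟙-¬T (λ t → x∉M (T⇒∈ t)))) (cong (_+ 𝟙 (not (inN x))) (*-zeroʳ m))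

  cover≤profile : ∀ x → cover x ≤ profile x
  cover≤profile x with x Subₚ.∈? M | T? (inN x)
  ... | yes x∈M | _       = subst (cover x ≤_) (sym (profile-core x∈M)) (count≤n (λ i → lookup (A i) x))
  ... | no  x∉M | yes x∈N = subst (_≤ profile x) (sym (adjacent-uncovered x∉M (T⇒∈ x∈N))) z≤n
  ... | no  x∉M | no  x∉N = subst (cover x ≤_) (sym (trans (profile-outside x∉M) (𝟙-T (not⁺ x∉N)))) (outside-core x∉M)

  profile-total : ∑ profile + ∣ N 𝔭 M ∣ ≡ m * ∣ M ∣ + n
  profile-total = begin
    ∑ profile + ∣ N 𝔭 M ∣
      ≡⟨ cong₂ _+_ (∑-distrib-+ (λ x → m * 𝟙 (lookup M x)) (λ x → 𝟙 (not (inN x)))) (∣∣-count (N 𝔭 M)) ⟩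
    ∑ (λ x → m * 𝟙 (lookup M x)) + count (λ x → not (inN x)) + count inN
      ≡⟨ +-assoc (∑ (λ x → m * 𝟙 (lookup M x))) _ _ ⟩
    ∑ (λ x → m * 𝟙 (lookup M x)) + (count (λ x → not (inN x)) + count inN)
      ≡⟨ cong₂ _+_ (sym (*-distribˡ-sum m (λ x → 𝟙 (lookup M x)))) (count-not inN) ⟩
    m * count (lookup M) + n
      ≡⟨ cong (λ c → m * c + n) (∣∣-count M) ⟨
    m * ∣ M ∣ + n ∎
    where open ≡-Reasoning

  slack : ℕ
  slack = proj₁ (m≤n⇒∃[o]m+o≡n (∑-mono cover≤profile))

  counting : sizeSum A + ∣ N 𝔭 M ∣ + slack ≡ m * ∣ M ∣ + n
  counting = begin
    sizeSum A + ∣ N 𝔭 M ∣ + slack   ≡⟨ +-assoc (sizeSum A) _ slack ⟩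
    sizeSum A + (∣ N 𝔭 M ∣ + slack) ≡⟨ cong₂ _+_ (sizeSum-by-points A) (+-comm ∣ N 𝔭 M ∣ slack) ⟩
    ∑ cover + (slack + ∣ N 𝔭 M ∣)   ≡⟨ +-assoc (∑ cover) slack _ ⟨
    ∑ cover + slack + ∣ N 𝔭 M ∣     ≡⟨ cong (_+ ∣ N 𝔭 M ∣) (proj₂ (m≤n⇒∃[o]m+o≡n (∑-mono cover≤profile))) ⟩
    ∑ profile + ∣ N 𝔭 M ∣           ≡⟨ profile-total ⟩
    m * ∣ M ∣ + n                   ∎
    where open ≡-Reasoning

  module Tight (no-slack : slack ≡ 0) where

    cover≡profile : ∀ x → cover x ≡ profile x
    cover≡profile = ∑-tight cover profile cover≤profile (≤-reflexive (begin
      ∑ profile         ≡⟨ proj₂ (m≤n⇒∃[o]m+o≡n (∑-mono cover≤profile)) ⟨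
      ∑ cover + slack   ≡⟨ cong (∑ cover +_) no-slack ⟩
      ∑ cover + 0       ≡⟨ +-identityʳ (∑ cover) ⟩
      ∑ cover           ∎))
      where open ≡-Reasoning

    core-in-all : ∀ {x} → x ∈ M → ∀ i → x ∈ A i
    core-in-all {x} x∈M i = T⇒∈ (count-all (λ j → lookup (A j) x)
      (≤-reflexive (sym (trans (cover≡profile x) (profile-core x∈M)))) i)

    cover-outside : ∀ {x} → x ∉ M → cover x ≡ 𝟙 (not (inN x))
    cover-outside {x} x∉M = trans (cover≡profile x) (profile-outside x∉M)

    -- An empty core: every point is covered exactly once, and by connectivity
    -- the member A_1 containing a point spreads to all of X.
    shapeI : Connected 𝔭 → Nonempty (A zero) → ∣ M ∣ ≡ 0 → ShapeI A
    shapeI conn (x₀ , x₀∈) ∣M∣≡0 = Subₚ.⊆-antisym Subₚ.⊆⊤ (λ {y} _ → in-A₁ y (conn x₀ y))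
                                 , λ j → Subₚ.⊆-antisym (λ {y} y∈ → ⊥-elim (¬core (core⁺ zero (suc j) (λ ()) (in-A₁ y (conn x₀ y)) y∈))) Subₚ.⊥⊆
      where
      ¬core : ∀ {x} → x ∉ M
      ¬core {x} x∈ = count-none (lookup M) (trans (sym (∣∣-count M)) ∣M∣≡0) x (∈⇒T x∈)
      ¬adjacent : ∀ {x} → x ∉ N 𝔭 M
      ¬adjacent x∈N with ∈N⁻ 𝔭 M x∈N
      ... | inj₁ x∈M           = ¬core x∈M
      ... | inj₂ (a , a∈M , _) = ¬core a∈M
      covered : ∀ y → ∃ λ i → y ∈ A i
      covered y with count-pos (λ i → lookup (A i) y) (subst (0 <_) (sym once) (s≤s z≤n))
        where
        once : cover y ≡ 1
        once = trans (cover-outside ¬core) (𝟙-T (not⁺ (λ y∈N → ¬adjacent (T⇒∈ y∈N))))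
      ... | i , y∈i = i , T⇒∈ y∈i
      in-A₁ : ∀ y → Reach 𝔭 x₀ y → y ∈ A zero
      in-A₁ _ here = x₀∈
      in-A₁ y (step {b} r (_ , by∉)) with covered y
      ... | i , y∈i with i ≟ zero
      ...   | yes refl = y∈i
      ...   | no  i≢0  = ⊥-elim (by∉ (cross zero i (λ 0≡i → i≢0 (sym 0≡i)) b y (in-A₁ b r) y∈i))

    -- A core whose neighbourhood is all of X: nothing outside the core is
    -- covered, so every member equals the core.
    shapeII : M ∈𝔭 𝔭 → ∣ M ∣ ≡ α 𝔭 → ∣ N 𝔭 M ∣ ≡ n → ShapeII 𝔭 A
    shapeII M∈ ∣M∣≡α ∣N∣≡n = M , M∈ , ∣M∣≡α , λ i → Subₚ.⊆-antisym (A⊆M i) (λ x∈M → core-in-all x∈M i)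
      where
      A⊆M : ∀ i → A i ⊆ M
      A⊆M i {x} x∈ with x Subₚ.∈? M
      ... | yes x∈M = x∈M
      ... | no  x∉M = ⊥-elim (count-none (λ j → lookup (A j) x) uncovered i (∈⇒T x∈))
        where
        uncovered : cover x ≡ 0
        uncovered = trans (cover-outside x∉M)
          (𝟙-¬T (λ t → not⁻ t (count-all inN (≤-reflexive (trans (sym ∣N∣≡n) (∣∣-count (N 𝔭 M)))) x)))

    shapeIII : Nonempty M → M ∈𝔭 𝔭 → ∣ M ∣ < α 𝔭 → ∣ M ∣ * n ≡ α 𝔭 * ∣ N 𝔭 M ∣ → ShapeIII 𝔭 A
    shapeIII nonempty M∈ ∣M∣<α ratio-tight =
      M , (nonempty , M∈ , ∣M∣<α , ratio-tight) , (λ i x∈M → core-in-all x∈M i)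
        , (λ i j i≢j x y x∈ y∈ → cross i j i≢j x y (Subₚ.p─q⊆p (A i) M x∈) (Subₚ.p─q⊆p (A j) M y∈))
        , disjoint , inside , covering
      where
      outside-N : ∀ {i x} → x ∈ A i → x ∉ M → x ∉ N 𝔭 M
      outside-N {i} {x} x∈ x∉M x∈N = 1+n≰n (begin
        1                      ≡⟨ 𝟙-T (∈⇒T x∈) ⟨
        𝟙 (lookup (A i) x)     ≤⟨ ∑-point (λ j → 𝟙 (lookup (A j) x)) i ⟩
        cover x                ≡⟨ cover-outside x∉M ⟩
        𝟙 (not (inN x))        ≡⟨ 𝟙-¬T (λ t → not⁻ t (∈⇒T x∈N)) ⟩
        0                      ∎)
        where open ≤-Reasoning
      disjoint : ∀ i j → ¬ i ≡ j → ∀ x → x ∈ A i ─ M → x ∈ A j ─ M → Empty.⊥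
      disjoint i j i≢j x x∈i x∈j = ∈─⇒∉ (A i) M x∈i (core⁺ i j i≢j (Subₚ.p─q⊆p (A i) M x∈i) (Subₚ.p─q⊆p (A j) M x∈j))
      inside : ∀ i → A i ─ M ⊆ N̄ 𝔭 M
      inside i x∈ = Equivalence.from ∈∁⇔∉ (outside-N (Subₚ.p─q⊆p (A i) M x∈) (∈─⇒∉ (A i) M x∈))
      covering : ∀ x → x ∈ N̄ 𝔭 M → ∃ λ i → x ∈ A i ─ M
      covering x x∈N̄ with count-pos (λ i → lookup (A i) x) (subst (0 <_) (sym once) (s≤s z≤n))
        where
        x∉N : x ∉ N 𝔭 M
        x∉N = Equivalence.to ∈∁⇔∉ x∈N̄
        x∉M : x ∉ M
        x∉M x∈M = x∉N (∈N⁺ˡ 𝔭 M x∈M)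
        once : cover x ≡ 1
        once = trans (cover-outside x∉M) (𝟙-T (not⁺ (λ t → x∉N (T⇒∈ t))))
      ... | i , x∈i = i , Subₚ.x∈p∧x∉q⇒x∈p─q (T⇒∈ x∈i) (λ x∈M → Equivalence.to ∈∁⇔∉ x∈N̄ (∈N⁺ˡ 𝔭 M x∈M))

𝟙-∈ : ∀ {n} {A : Subset n} {x} → x ∈ A → 𝟙 (lookup A x) ≡ 1
𝟙-∈ x∈ = 𝟙-T (∈⇒T x∈)

𝟙-∉ : ∀ {n} {A : Subset n} {x} → x ∉ A → 𝟙 (lookup A x) ≡ 0
𝟙-∉ x∉ = 𝟙-¬T (λ t → x∉ (T⇒∈ t))

𝟙-─ : ∀ {n} {A C : Subset n} → C ⊆ A → ∀ x → 𝟙 (lookup A x) ≡ 𝟙 (lookup C x) + 𝟙 (lookup (A ─ C) x)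
𝟙-─ {A = A} {C} C⊆A x with x Subₚ.∈? C | x Subₚ.∈? A
... | yes x∈C | _       = trans (𝟙-∈ (C⊆A x∈C)) (sym (cong₂ _+_ (𝟙-∈ x∈C) (𝟙-∉ (λ x∈ → ∈─⇒∉ A C x∈ x∈C))))
... | no  x∉C | yes x∈A = trans (𝟙-∈ x∈A) (sym (cong₂ _+_ (𝟙-∉ x∉C) (𝟙-∈ (Subₚ.x∈p∧x∉q⇒x∈p─q x∈A x∉C))))
... | no  x∉C | no  x∉A = trans (𝟙-∉ x∉A) (sym (cong₂ _+_ (𝟙-∉ x∉C) (𝟙-∉ (λ x∈ → x∉A (Subₚ.p─q⊆p A C x∈)))))

bound-≤ : ∀ n m a → m * a ≤ n → bound n m a ≡ n
bound-≤ n m a ma≤n with m * a ≤ᵇ n in eq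
... | true  = refl
... | false = ⊥-elim (subst T eq (≤⇒≤ᵇ ma≤n))

bound-> : ∀ n m a → n < m * a → bound n m a ≡ m * a
bound-> n m a n<ma with m * a ≤ᵇ n in eq
... | true  = ⊥-elim (<⇒≱ n<ma (≤ᵇ⇒≤ (m * a) n (subst T (sym eq) _)))
... | false = refl

module Extremal {n k} (𝔭 : Family n) (A : Fin (suc k) → Subset n) where

  m : ℕ
  m = suc k

  ∑∣A∣ : sizeSum A ≡ ∑ (λ i → ∣ A i ∣)
  ∑∣A∣ = sum-tabulate (λ i → ∣ A i ∣)

  shapeI-size : ShapeI A → sizeSum A ≡ n
  shapeI-size (A₁≡⊤ , rest≡⊥) = begin
    sizeSum A                              ≡⟨ ∑∣A∣ ⟩
    ∣ A zero ∣ + ∑ (λ j → ∣ A (suc j) ∣)    ≡⟨ cong₂ _+_ (trans (cong ∣_∣ A₁≡⊤) (Subₚ.∣⊤∣≡n n)) (sum-cong-≗ (λ j → trans (cong ∣_∣ (rest≡⊥ j)) (Subₚ.∣⊥∣≡0 n))) ⟩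
    n + ∑ {k} (λ _ → 0)                    ≡⟨ cong (n +_) (trans (∑-const k 0) (*-zeroʳ k)) ⟩
    n + 0                                  ≡⟨ +-identityʳ n ⟩
    n                                      ∎
    where open ≡-Reasoning

  shapeII-size : ShapeII 𝔭 A → sizeSum A ≡ m * α 𝔭
  shapeII-size (I , _ , ∣I∣≡α , A≡I) =
    trans ∑∣A∣ (trans (sum-cong-≗ (λ i → trans (cong ∣_∣ (A≡I i)) ∣I∣≡α)) (∑-const m (α 𝔭)))

  -- In shape (iii) each point of C is covered m times and each point of
  -- X ∖ N[C] once, so Σ|A_i| = m·|C| + n − |N[C]| = n, using m·|C| = |N[C]|.
  shapeIII-size : m * α 𝔭 ≡ n → ShapeIII 𝔭 A → sizeSum A ≡ n
  shapeIII-size mα≡n (C , (_ , _ , ∣C∣<α , ratio) , C⊆A , _ , (disjoint , inside , covering)) =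
    +-cancelʳ-≡ ∣ N 𝔭 C ∣ (sizeSum A) n (trans total (trans (cong (_+ n) m∣C∣≡∣N∣) (+-comm ∣ N 𝔭 C ∣ n)))
    where
    parts : ∀ x → count (λ i → lookup (A i ─ C) x) ≡ 𝟙 (lookup (N̄ 𝔭 C) x)
    parts x with x Subₚ.∈? N̄ 𝔭 C
    ... | yes x∈ = trans (≤-antisym
                     (count-≤1 _ (λ i j i≢j x∈i x∈j → disjoint i j i≢j x (T⇒∈ x∈i) (T⇒∈ x∈j)))
                     (let (i , x∈i) = covering x x∈ in
                      subst (_≤ count (λ i → lookup (A i ─ C) x)) (𝟙-∈ x∈i) (∑-point (λ i → 𝟙 (lookup (A i ─ C) x)) i)))
                   (sym (𝟙-∈ x∈))
    ... | no  x∉ = trans (trans (sum-cong-≗ (λ i → 𝟙-∉ (λ x∈i → x∉ (inside i x∈i)))) (trans (∑-const m 0) (*-zeroʳ m)))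
                         (sym (𝟙-∉ x∉))
    cover : ∀ x → count (λ i → lookup (A i) x) ≡ m * 𝟙 (lookup C x) + 𝟙 (lookup (N̄ 𝔭 C) x)
    cover x = begin
      ∑ (λ i → 𝟙 (lookup (A i) x))                                     ≡⟨ sum-cong-≗ (λ i → 𝟙-─ (C⊆A i) x) ⟩
      ∑ (λ i → 𝟙 (lookup C x) + 𝟙 (lookup (A i ─ C) x))                ≡⟨ ∑-distrib-+ (λ _ → 𝟙 (lookup C x)) (λ i → 𝟙 (lookup (A i ─ C) x)) ⟩
      ∑ {m} (λ _ → 𝟙 (lookup C x)) + count (λ i → lookup (A i ─ C) x)  ≡⟨ cong₂ _+_ (∑-const m _) (parts x) ⟩
      m * 𝟙 (lookup C x) + 𝟙 (lookup (N̄ 𝔭 C) x)                       ∎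
      where open ≡-Reasoning
    inN : Fin n → Bool
    inN = lookup (N 𝔭 C)
    total : sizeSum A + ∣ N 𝔭 C ∣ ≡ m * ∣ C ∣ + n
    total = begin
      sizeSum A + ∣ N 𝔭 C ∣
        ≡⟨ cong₂ _+_ (trans (sizeSum-by-points A) (sum-cong-≗ cover)) (∣∣-count (N 𝔭 C)) ⟩
      ∑ (λ x → m * 𝟙 (lookup C x) + 𝟙 (lookup (N̄ 𝔭 C) x)) + count inN
        ≡⟨ cong (_+ count inN) (∑-distrib-+ (λ x → m * 𝟙 (lookup C x)) (λ x → 𝟙 (lookup (N̄ 𝔭 C) x))) ⟩
      ∑ (λ x → m * 𝟙 (lookup C x)) + count (lookup (N̄ 𝔭 C)) + count inN
        ≡⟨ +-assoc (∑ (λ x → m * 𝟙 (lookup C x))) _ _ ⟩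
      ∑ (λ x → m * 𝟙 (lookup C x)) + (count (lookup (N̄ 𝔭 C)) + count inN)
        ≡⟨ cong₂ _+_ (sym (*-distribˡ-sum m (λ x → 𝟙 (lookup C x))))
                     (trans (cong (_+ count inN) (sum-cong-≗ (λ x → cong 𝟙 (Vecₚ.lookup-map x not (N 𝔭 C))))) (count-not inN)) ⟩
      m * count (lookup C) + n
        ≡⟨ cong (λ c → m * c + n) (∣∣-count C) ⟨
      m * ∣ C ∣ + n ∎
      where open ≡-Reasoning
    -- |C|·n = α·|N[C]| and n = m·α give m·|C| = |N[C]|.
    m∣C∣≡∣N∣ : m * ∣ C ∣ ≡ ∣ N 𝔭 C ∣
    m∣C∣≡∣N∣ = *-cancelˡ-≡ (m * ∣ C ∣) ∣ N 𝔭 C ∣ (α 𝔭) {{>-nonZero (≤-<-trans z≤n ∣C∣<α)}} (begin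
      α 𝔭 * (m * ∣ C ∣) ≡⟨ rearrange (α 𝔭) m ∣ C ∣ ⟩
      ∣ C ∣ * (m * α 𝔭) ≡⟨ cong (∣ C ∣ *_) mα≡n ⟩
      ∣ C ∣ * n         ≡⟨ ratio ⟩
      α 𝔭 * ∣ N 𝔭 C ∣   ∎)
      where
      open ≡-Reasoning
      rearrange : ∀ a m c → a * (m * c) ≡ c * (m * a)
      rearrange = solve-∀

  ExtremalShape : Set
  ExtremalShape = (m * α 𝔭 < n × ShapeI A) ⊎ (n < m * α 𝔭 × ShapeII 𝔭 A)
                ⊎ (m * α 𝔭 ≡ n × (ShapeI A ⊎ ShapeII 𝔭 A ⊎ ShapeIII 𝔭 A))

  shape⇒attained : ExtremalShape → sizeSum A ≡ bound n m (α 𝔭)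
  shape⇒attained (inj₁ (mα<n , sI))                   = trans (shapeI-size sI) (sym (bound-≤ n m (α 𝔭) (<⇒≤ mα<n)))
  shape⇒attained (inj₂ (inj₁ (n<mα , sII)))           = trans (shapeII-size sII) (sym (bound-> n m (α 𝔭) n<mα))
  shape⇒attained (inj₂ (inj₂ (mα≡n , inj₁ sI)))       = trans (shapeI-size sI) (sym (bound-≤ n m (α 𝔭) (≤-reflexive mα≡n)))
  shape⇒attained (inj₂ (inj₂ (mα≡n , inj₂ (inj₁ sII)))) =
    trans (shapeII-size sII) (trans mα≡n (sym (bound-≤ n m (α 𝔭) (≤-reflexive mα≡n))))
  shape⇒attained (inj₂ (inj₂ (mα≡n , inj₂ (inj₂ sIII)))) =
    trans (shapeIII-size mα≡n sIII) (sym (bound-≤ n m (α 𝔭) (≤-reflexive mα≡n)))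

module CrossFamilyBound {n} (𝔭 : Family n) (dc : DownClosed 𝔭) (pc : PairwiseClosed 𝔭)
                        (si : SingletonsIn 𝔭) (Γ : Group 0ℓ 0ℓ) (sym𝔭 : SymmetricVia Γ 𝔭)
                        (conn : Connected 𝔭) {k} (A : Fin (suc k) → Subset n)
                        (cross : CrossFamily 𝔭 A) (nonempty : Nonempty (A zero)) where

  open Independence 𝔭 dc pc si
  open Core 𝔭 dc pc si A cross
  open Extremal 𝔭 A using (ExtremalShape)

  x₀ : Fin n
  x₀ = proj₁ nonempty

  M∈𝔭 : M ∈𝔭 𝔭
  M∈𝔭 = pairwise⇒∈𝔭 x₀ core-indep

  ratio : ∃ λ w → n * ∣ M ∣ + w ≡ α 𝔭 * ∣ N 𝔭 M ∣
  ratio = m≤n⇒∃[o]m+o≡n (RatioBound.ratio-bound 𝔭 dc pc si Γ sym𝔭 x₀ M M∈𝔭)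

  w : ℕ
  w = proj₁ ratio

  module Bounds = Balance (α 𝔭) m n (sizeSum A) ∣ M ∣ ∣ N 𝔭 M ∣ slack w (α-pos x₀) (α-ub M∈𝔭)
                          counting (proj₂ ratio)
  open Bounds public using (below; above)

  full : ∣ M ∣ ≡ α 𝔭 → w ≡ 0 → ∣ N 𝔭 M ∣ ≡ n
  full ∣M∣≡α w≡0 = sym (*-cancelˡ-≡ n ∣ N 𝔭 M ∣ (α 𝔭) {{>-nonZero (α-pos x₀)}} (begin
    α 𝔭 * n         ≡⟨ *-comm (α 𝔭) n ⟩
    n * α 𝔭         ≡⟨ cong (n *_) ∣M∣≡α ⟨
    n * ∣ M ∣       ≡⟨ +-identityʳ (n * ∣ M ∣) ⟨
    n * ∣ M ∣ + 0   ≡⟨ cong (n * ∣ M ∣ +_) w≡0 ⟨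
    n * ∣ M ∣ + w   ≡⟨ proj₂ ratio ⟩
    α 𝔭 * ∣ N 𝔭 M ∣ ∎))
    where open ≡-Reasoning

  balanced-shape : slack ≡ 0 → w ≡ 0 → ShapeI A ⊎ ShapeII 𝔭 A ⊎ ShapeIII 𝔭 A
  balanced-shape u≡0 w≡0 with ∣ M ∣ ℕ.≟ 0 | ∣ M ∣ ℕ.≟ α 𝔭
  ... | yes ∣M∣≡0 | _        = inj₁ (Tight.shapeI u≡0 conn nonempty ∣M∣≡0)
  ... | no  _     | yes ∣M∣≡α = inj₂ (inj₁ (Tight.shapeII u≡0 M∈𝔭 ∣M∣≡α (full ∣M∣≡α w≡0)))
  ... | no  ∣M∣≢0 | no  ∣M∣≢α = inj₂ (inj₂ (Tight.shapeIII u≡0 core-nonempty M∈𝔭 (≤∧≢⇒< (α-ub M∈𝔭) ∣M∣≢α) imprimitive))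
    where
    core-nonempty : Nonempty M
    core-nonempty = let (x , x∈) = count-pos (lookup M) (subst (0 <_) (∣∣-count M) (n≢0⇒n>0 ∣M∣≢0)) in x , T⇒∈ x∈
    imprimitive : ∣ M ∣ * n ≡ α 𝔭 * ∣ N 𝔭 M ∣
    imprimitive = trans (*-comm ∣ M ∣ n) (trans (sym (+-identityʳ _)) (trans (cong (n * ∣ M ∣ +_) (sym w≡0)) (proj₂ ratio)))

  attained⇒shape : sizeSum A ≡ bound n m (α 𝔭) → ExtremalShape
  attained⇒shape attained with <-cmp (m * α 𝔭) n
  ... | tri< mα<n _ _ =
    let (d , mα+1+d≡n) = m≤n⇒∃[o]m+o≡n mα<n
        (dt≡0 , _ , u≡0) = Bounds.tight-below (suc d) (trans (+-suc _ d) mα+1+d≡n) (trans attained (bound-≤ n m (α 𝔭) (<⇒≤ mα<n)))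
    in inj₁ (mα<n , Tight.shapeI u≡0 conn nonempty (*-≡0 {suc d} ∣ M ∣ (s≤s z≤n) dt≡0))
  ... | tri≈ _ mα≡n _ =
    let (_ , w≡0 , u≡0) = Bounds.tight-below 0 (trans (+-identityʳ _) mα≡n) (trans attained (bound-≤ n m (α 𝔭) (≤-reflexive mα≡n)))
    in inj₂ (inj₂ (mα≡n , balanced-shape u≡0 w≡0))
  ... | tri> _ _ n<mα =
    let (∣M∣≡α , w≡0 , u≡0) = Bounds.tight-above n<mα (trans attained (bound-> n m (α 𝔭) n<mα))
    in inj₂ (inj₁ (n<mα , Tight.shapeII u≡0 M∈𝔭 ∣M∣≡α (full ∣M∣≡α w≡0)))

theorem2p5 : (n : ℕ) (𝔭 : Family n) → DownClosed 𝔭 → PairwiseClosed 𝔭 → SingletonsIn 𝔭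
    → Symmetric 𝔭 → Connected 𝔭
    → (k : ℕ) (A : Fin (suc k) → Subset n) → CrossFamily 𝔭 A → Nonempty (A zero)
    → (suc k * α 𝔭 ≤ n → sizeSum A ≤ n)
    × (n ≤ suc k * α 𝔭 → sizeSum A ≤ suc k * α 𝔭)
    × (sizeSum A ≡ bound n (suc k) (α 𝔭)
       ⇔ ((suc k * α 𝔭 < n × ShapeI A)
          ⊎ (n < suc k * α 𝔭 × ShapeII 𝔭 A)
          ⊎ (suc k * α 𝔭 ≡ n × (ShapeI A ⊎ ShapeII 𝔭 A ⊎ ShapeIII 𝔭 A))))
theorem2p5 n 𝔭 dc pc si (Γ , sym𝔭) conn k A cross nonempty =
  below , above , mk⇔ attained⇒shape (Extremal.shape⇒attained 𝔭 A)
  where open CrossFamilyBound 𝔭 dc pc si Γ sym𝔭 conn A cross nonempty
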